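{- Let $w, k$ be integers with $3 < w < k+2$, let $t = \lceil \frac{w+k}{2} \rceil$ and $p = (w+k) \bmod 2$, and let $\Sigma$ be a totally ordered alphabet containing distinct letters $\mathtt{a},\mathtt{b}$. Let $T = (\mathtt{a}\mathtt{b})^t\mathtt{b}\mathtt{b}$ and $L = |T| = 2t+2$. Let $S \in \Sigma^n$ and $s$ be such that $S[s-2L \mathinner{.\,.} s+3L-1] = T^5$, and let $M_{\mathtt{a}<\mathtt{b}}$ (resp. $M_{\mathtt{b}<\mathtt{a}}$) be the number of elements of $\mathcal{M}_{w,k}(S)$ in $[s, s+L-1]$ when $\mathtt{a}<\mathtt{b}$ (resp. $\mathtt{b}<\mathtt{a}$). Then: if $k$ is even, $M_{\mathtt{a}<\mathtt{b}} = \frac{k}{2} + 2 + p$ and $M_{\mathtt{b}<\mathtt{a}} = \frac{k}{2} + 3 + p$; if $k$ is odd, $M_{\mathtt{a}<\mathtt{b}} = \lfloor \frac{k}{2} \rfloor + 3$ and $M_{\mathtt{b}<\mathtt{a}} = \lfloor \frac{k}{2} \rfloor + 4$.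
   Context: Strings are 1-indexed; $X^q$ denotes the concatenation of $q$ copies of $X$. For a string $S$ of length $n$ over a totally ordered alphabet (order extended lexicographically to strings) and integers $w \ge 2$, $k \ge 1$: for each $i \in [1, n-w-k+2]$, the minimizer of the window $S[i\mathinner{.\,.} i+w+k-2]$ is the smallest position $j \in [i, i+w-1]$ such that $S[j\mathinner{.\,.} j+k-1]$ is lexicographically smallest among the fragments $S[j'\mathinner{.\,.} j'+k-1]$, $j' \in [i,i+w-1]$; $\mathcal{M}_{w,k}(S)$ is the set of all such minimizers. -}

module Defs where

open import Level using (0ℓ)
open import Data.Nat using (ℕ; _+_; _*_; _∸_; _≤_; _<_)
open import Data.Nat.DivMod using (_/_; _%_)
open import Data.Product using (Σ; _×_)
open import Data.List using (List; []; _∷_; take; drop; length; concat; replicate; _++_)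
open import Data.List.Membership.Propositional using (_∈_)
open import Data.List.Relation.Unary.Unique.Propositional using (Unique)
open import Data.List.Relation.Binary.Lex.Strict using (Lex-≤)
open import Data.Vec using (Vec; toList)
open import Relation.Binary.Core using (Rel)
open import Relation.Binary.PropositionalEquality using (_≡_)
open import Relation.Nullary using (¬_)
open import Function.Bundles using (_⇔_)

-- Strings are 1-indexed.  S[j .. j+k-1], the fragment of length k starting
-- at (1-indexed) position j.
fragment : {A : Set} {n : ℕ} → Vec A n → ℕ → ℕ → List A
fragment S j k = take k (drop (j ∸ 1) (toList S))

module Minimizers {A : Set} (_≺_ : Rel A 0ℓ) where

  _≼_ : List A → List A → Set
  _≼_ = Lex-≤ _≡_ _≺_

  module _ {n : ℕ} (S : Vec A n) (w k : ℕ) where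

    InWin : ℕ → ℕ → Set
    InWin i j = i ≤ j × j ≤ i + w ∸ 1

    LexSmallest : ℕ → ℕ → Set
    LexSmallest i j = InWin i j × (∀ j' → InWin i j' → fragment S j k ≼ fragment S j' k)

    -- j is the minimizer of the window S[i .. i+w+k-2]:
    -- the smallest position j ∈ [i, i+w-1] whose k-mer is lexicographically smallest
    IsMinimizer : ℕ → ℕ → Set
    IsMinimizer i j = LexSmallest i j × (∀ j' → i ≤ j' → j' < j → ¬ LexSmallest i j')

    InM : ℕ → Set
    InM j = Σ ℕ λ i → (1 ≤ i × i ≤ n + 2 ∸ (w + k)) × IsMinimizer i j

HasCount : (ℕ → Set) → ℕ → Set
HasCount P N = Σ (List ℕ) λ xs → length xs ≡ N × Unique xs × (∀ x → (x ∈ xs) ⇔ P x)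

Tword : {A : Set} → A → A → ℕ → List A
Tword a b t = concat (replicate t (a ∷ b ∷ [])) ++ (b ∷ b ∷ [])

-- On S[s − 2L .. s + 3L − 1] = T⁵ the string is periodic, so the k-mer at a position depends
-- only on its offset r in T = (ab)ᵗbb: it is the alternating word that begins with T[r], except
-- that the first b of bb (offset 2t) may sit inside it as a defect where the alternation would
-- put an a.  For each order of a and b every offset gets a number, its key, such that a smaller
-- key means a lexicographically smaller k-mer and equal keys below a threshold mean equal
-- k-mers; minimizers are then leftmost key minima of windows.  A position of the middle copy of
-- T is a minimizer if some window has it as leftmost key minimum, and it is not if an earlier
-- position of no larger key and a later position of smaller key lie at most w apart around it.
-- For a ≺ b this singles out the even offsets r with r + w ≤ 2t + 3, that is t + 2 − ⌊w/2⌋ of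
-- them; for b ≺ a there is one more: the odd offsets whose window misses the defect, the odd
-- offsets whose k-mer contains it, and both letters of bb.  The closed forms in the statement
-- follow by computing t = ⌈(w + k)/2⌉ from the parities of w and k.

module Submission where

open import Defs
open import Level using (0ℓ)
open import Data.Empty using (⊥; ⊥-elim)
open import Data.List using (List; []; _∷_; _++_; take; drop; length; map; concat; replicate; applyUpTo)
open import Data.List.Membership.Propositional using (_∈_)
open import Data.List.Membership.Propositional.Properties using (∈-map⁺; ∈-map⁻; ∈-applyUpTo⁺; ∈-applyUpTo⁻; ∈-++⁺ˡ; ∈-++⁺ʳ; ∈-++⁻)
open import Data.List.Properties using (take-drop; take-take; drop-drop; length-take; length-drop; length-map; length-applyUpTo; length-++)
open import Data.List.Relation.Binary.Lex.Core using (this; next)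
open import Data.List.Relation.Binary.Lex.Strict as Lex using (Lex-<)
open import Data.List.Relation.Binary.Pointwise using (≡⇒Pointwise-≡; Pointwise-≡⇒≡)
open import Data.List.Relation.Unary.All using () renaming ([] to []ᵃ; _∷_ to _∷ᵃ_)
open import Data.List.Relation.Unary.AllPairs using () renaming ([] to []ᴬ; _∷_ to _∷ᴬ_)
open import Data.List.Relation.Unary.Any using (here; there)
open import Data.List.Relation.Unary.Unique.Propositional using (Unique)
import Data.List.Relation.Unary.Unique.Propositional.Properties as Unique
open import Data.Nat using (ℕ; zero; suc; pred; _+_; _*_; _∸_; _≤_; _<_; _⊓_; z≤n; s≤s; _<?_; _≤?_; parity; >-nonZero)
open import Data.Nat.DivMod using (_/_; _%_; m<n⇒m%n≡m; m%n<n; [m+n]%n≡m%n; [m+kn]%n≡m%n; %-distribˡ-+; m%n%n≡m%n; m*n/n≡m; m*n%n≡0; +-distrib-/)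
open import Data.Nat.Properties
open import Data.Nat.Tactic.RingSolver using (solve)
open import Data.Parity.Base as ℙ using (Parity; 0ℙ; 1ℙ)
open import Data.Parity.Properties using (+-homo-+; *-homo-*)
open import Data.Product using (Σ; _×_; _,_; proj₁; proj₂)
open import Data.Sum using (_⊎_; inj₁; inj₂)
open import Data.Vec using (Vec; toList)
open import Data.Vec.Properties using (length-toList)
open import Function using (_∘_)
open import Function.Bundles using (_⇔_; mk⇔)
open import Relation.Binary.Core using (Rel)
open import Relation.Binary.PropositionalEquality
open import Relation.Binary.Structures using (IsStrictTotalOrder)
open import Relation.Nullary using (¬_; yes; no; contradiction)

<⇒≤∸1 : ∀ {m n} → m < n → m ≤ n ∸ 1
<⇒≤∸1 (s≤s m≤n) = m≤n

≤∸1⇒< : ∀ {m n} → 0 < n → m ≤ n ∸ 1 → m < n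
≤∸1⇒< {n = suc n} _ m≤n = s≤s m≤n

<∸⇒+< : ∀ {m n o} → n ≤ o → m < o ∸ n → n + m < o
<∸⇒+< {m} {n} {o} n≤o lt = subst (_< o) (+-comm m n) (m≤o∸n⇒m+n≤o (suc m) n≤o lt)

≤∸⇒+≤ : ∀ {m n o} → n ≤ o → m ≤ o ∸ n → n + m ≤ o
≤∸⇒+≤ {m} {n} {o} n≤o le = subst (_≤ o) (+-comm m n) (m≤o∸n⇒m+n≤o m n≤o le)

<+⇒∸< : ∀ {m n o} → n ≤ m → m < n + o → m ∸ n < o
<+⇒∸< {m} {n} {o} n≤m m<n+o = +-cancelʳ-< n (m ∸ n) o (subst₂ _<_ (sym (m∸n+n≡m n≤m)) (+-comm n o) m<n+o)

m∸n<m : ∀ {m n} → 0 < m → 0 < n → m ∸ n < m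
m∸n<m {suc m} {suc n} _ _ = s≤s (m∸n≤m m n)

∸-≡-cases : ∀ m n o → m ∸ n ≡ m ∸ o → n ≡ o ⊎ (m ≤ n × m ≤ o)
∸-≡-cases zero    n       o       _  = inj₂ (z≤n , z≤n)
∸-≡-cases (suc m) zero    zero    _  = inj₁ refl
∸-≡-cases (suc m) zero    (suc o) eq = contradiction eq (1+m≢m∸n o)
∸-≡-cases (suc m) (suc n) zero    eq = contradiction (sym eq) (1+m≢m∸n n)
∸-≡-cases (suc m) (suc n) (suc o) eq with ∸-≡-cases m n o eq
... | inj₁ n≡o         = inj₁ (cong suc n≡o)
... | inj₂ (m≤n , m≤o) = inj₂ (s≤s m≤n , s≤s m≤o)

m⊓n<n⇒m⊓n≡m : ∀ {m n} → m ⊓ n < n → m ⊓ n ≡ m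
m⊓n<n⇒m⊓n≡m {m} {n} lt with m ≤? n
... | yes m≤n = m≤n⇒m⊓n≡m m≤n
... | no m≰n  = contradiction (m≥n⇒m⊓n≡n (<⇒≤ (≰⇒> m≰n))) (<⇒≢ lt)

parity-2* : ∀ m → parity (2 * m) ≡ 0ℙ
parity-2* m = *-homo-* 2 m

parity-1+2* : ∀ m → parity (1 + 2 * m) ≡ 1ℙ
parity-1+2* m = trans (+-homo-+ 1 (2 * m)) (cong (1ℙ ℙ.+_) (parity-2* m))

parity-+-cong : ∀ {r r'} i → parity r ≡ parity r' → parity (r + i) ≡ parity (r' + i)
parity-+-cong {r} {r'} i eq = trans (+-homo-+ r i) (trans (cong (ℙ._+ parity i) eq) (sym (+-homo-+ r' i)))

even-or-odd : ∀ n → (Σ ℕ λ m → n ≡ 2 * m) ⊎ (Σ ℕ λ m → n ≡ 1 + 2 * m)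
even-or-odd zero = inj₁ (0 , refl)
even-or-odd (suc n) with even-or-odd n
... | inj₁ (m , refl) = inj₂ (m , refl)
... | inj₂ (m , refl) = inj₁ (suc m , sym (*-suc 2 m))

module LexOrder {A : Set} {_≺_ : Rel A 0ℓ} (sto : IsStrictTotalOrder _≡_ _≺_) where
  open Minimizers _≺_ using (_≼_)
  open IsStrictTotalOrder sto using (irrefl; asym)

  _≺ₗ_ : List A → List A → Set
  _≺ₗ_ = Lex-< _≡_ _≺_

  ≺ₗ⇒≼ : ∀ {xs ys} → xs ≺ₗ ys → xs ≼ ys
  ≺ₗ⇒≼ Lex.halt = Lex.halt
  ≺ₗ⇒≼ (this x≺y) = this x≺y
  ≺ₗ⇒≼ (next x≡y xs≺ys) = next x≡y (≺ₗ⇒≼ xs≺ys)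

  ≼-reflexive : ∀ {xs ys} → xs ≡ ys → xs ≼ ys
  ≼-reflexive = Lex.≤-reflexive _≡_ _≺_ ∘ ≡⇒Pointwise-≡

  ≼-antisym : ∀ {xs ys} → xs ≼ ys → ys ≼ xs → xs ≡ ys
  ≼-antisym xs≼ys ys≼xs = Pointwise-≡⇒≡ (Lex.≤-antisymmetric sym irrefl asym xs≼ys ys≼xs)

  ≺ₗ⇒⋡ : ∀ {xs ys} → xs ≺ₗ ys → ¬ ys ≼ xs
  ≺ₗ⇒⋡ xs≺ys ys≼xs with ≼-antisym (≺ₗ⇒≼ xs≺ys) ys≼xs
  ... | refl = Lex.<-irreflexive irrefl (≡⇒Pointwise-≡ refl) xs≺ys

  applyUpTo-≺ₗ : ∀ {f g : ℕ → A} {d} n → d < n → (∀ i → i < d → f i ≡ g i) → f d ≺ g d →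
                 applyUpTo f n ≺ₗ applyUpTo g n
  applyUpTo-≺ₗ {d = zero}  (suc n) _ _ fd≺gd = this fd≺gd
  applyUpTo-≺ₗ {d = suc d} (suc n) (s≤s d<n) f≡g fd≺gd =
    next (f≡g 0 (s≤s z≤n)) (applyUpTo-≺ₗ n d<n (λ i i<d → f≡g (suc i) (s≤s i<d)) fd≺gd)

applyUpTo-cong : ∀ {A : Set} {f g : ℕ → A} n → (∀ i → i < n → f i ≡ g i) → applyUpTo f n ≡ applyUpTo g n
applyUpTo-cong zero    _   = refl
applyUpTo-cong (suc n) f≡g = cong₂ _∷_ (f≡g 0 (s≤s z≤n)) (applyUpTo-cong n (λ i i<n → f≡g (suc i) (s≤s i<n)))

applyUpTo-++ : ∀ {A : Set} (f : ℕ → A) m n → applyUpTo f (m + n) ≡ applyUpTo f m ++ applyUpTo (λ i → f (m + i)) n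
applyUpTo-++ f zero    n = refl
applyUpTo-++ f (suc m) n = cong (f 0 ∷_) (applyUpTo-++ (λ i → f (suc i)) m n)

module _ {A : Set} {_≺_ : Rel A 0ℓ} (sto : IsStrictTotalOrder _≡_ _≺_)
         {n : ℕ} (S : Vec A n) (w k : ℕ) where
  open Minimizers _≺_
  open LexOrder sto

  private
    frag : ℕ → List A
    frag j = fragment S j k

  minimizer-intro : ∀ β {u x} → u ≤ x → x < u + w →
                    (∀ y → u ≤ y → y < u + w → frag (β + x) ≼ frag (β + y)) →
                    (∀ y → u ≤ y → y < x → frag (β + x) ≺ₗ frag (β + y)) →
                    IsMinimizer S w k (β + u) (β + x)
  minimizer-intro β {u} {x} u≤x x<u+w minimal leftmost = (x∈window , smallest) , no-earlier
    where
      x<β+u+w : β + x < β + u + w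
      x<β+u+w = subst (β + x <_) (sym (+-assoc β u w)) (+-monoʳ-< β x<u+w)
      x∈window : InWin S w k (β + u) (β + x)
      x∈window = +-monoʳ-≤ β u≤x , <⇒≤∸1 x<β+u+w
      relative : ∀ {j} → β + u ≤ j → Σ ℕ λ y → j ≡ β + y × u ≤ y
      relative {j} β+u≤j = j ∸ β , sym j≡ , +-cancelˡ-≤ β u (j ∸ β) (subst (β + u ≤_) (sym j≡) β+u≤j)
        where
          j≡ : β + (j ∸ β) ≡ j
          j≡ = m+[n∸m]≡n (≤-trans (m≤m+n β u) β+u≤j)
      smallest : ∀ j → InWin S w k (β + u) j → frag (β + x) ≼ frag j
      smallest j (β+u≤j , j≤) with relative β+u≤j
      ... | y , refl , u≤y =
        minimal y u≤y (+-cancelˡ-< β y (u + w) (subst (β + y <_) (+-assoc β u w) (≤∸1⇒< (≤-trans (s≤s z≤n) x<β+u+w) j≤)))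
      no-earlier : ∀ j → β + u ≤ j → j < β + x → ¬ LexSmallest S w k (β + u) j
      no-earlier j β+u≤j j<β+x (_ , j-smallest) with relative β+u≤j
      ... | y , refl , u≤y = ≺ₗ⇒⋡ (leftmost y u≤y (+-cancelˡ-< β y x j<β+x)) (j-smallest (β + x) x∈window)

  -- Every window containing x contains p, with a k-mer no larger, or q, with a smaller one.
  squeezed⇒¬minimizer : ∀ {i x p q} → IsMinimizer S w k i x →
                        p < x → x < q → q ≤ p + w →
                        frag p ≼ frag x → frag q ≺ₗ frag x → ⊥
  squeezed⇒¬minimizer {i} {x} {p} {q} (((i≤x , x≤) , smallest) , leftmost) p<x x<q q≤p+w p≼x q≺x
    with i ≤? p
  ... | yes i≤p = leftmost p i≤p p<x ((i≤p , ≤-trans (<⇒≤ p<x) x≤) , p-smallest)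
    where
      p≡x : frag p ≡ frag x
      p≡x = ≼-antisym p≼x (smallest p (i≤p , ≤-trans (<⇒≤ p<x) x≤))
      p-smallest : ∀ j → InWin S w k i j → frag p ≼ frag j
      p-smallest j j∈ = subst (_≼ frag j) (sym p≡x) (smallest j j∈)
  ... | no i≰p = ≺ₗ⇒⋡ q≺x (smallest q (≤-trans i≤x (<⇒≤ x<q) , <⇒≤∸1 q<i+w))
    where
      q<i+w : q < i + w
      q<i+w = ≤-trans (s≤s q≤p+w) (+-monoˡ-≤ w (≰⇒> i≰p))

take-drop-applyUpTo : ∀ {A : Set} (f : ℕ → A) y k N → y + k ≤ N →
                      take k (drop y (applyUpTo f N)) ≡ applyUpTo (λ i → f (y + i)) k
take-drop-applyUpTo f zero    zero    N       _        = refl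
take-drop-applyUpTo f zero    (suc k) (suc N) (s≤s le) = cong (f 0 ∷_) (take-drop-applyUpTo (f ∘ suc) zero k N le)
take-drop-applyUpTo f (suc y) k       (suc N) (s≤s le) = take-drop-applyUpTo (f ∘ suc) y k N le

take-drop-take : ∀ {A : Set} k y N (xs : List A) → y + k ≤ N → take k (drop y (take N xs)) ≡ take k (drop y xs)
take-drop-take k y N xs y+k≤N = begin
  take k (drop y (take N xs))        ≡⟨ take-drop k y (take N xs) ⟩
  drop y (take (y + k) (take N xs))  ≡⟨ cong (drop y) (take-take (y + k) N xs) ⟩
  drop y (take ((y + k) ⊓ N) xs)     ≡⟨ cong (λ m → drop y (take m xs)) (m≤n⇒m⊓n≡m y+k≤N) ⟩
  drop y (take (y + k) xs)           ≡⟨ take-drop k y xs ⟨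
  take k (drop y xs)                 ∎
  where open ≡-Reasoning

module _ {A : Set} {n : ℕ} (S : Vec A n) {β N : ℕ} {f : ℕ → A} (1≤β : 1 ≤ β)
         (S≡f : fragment S β N ≡ applyUpTo f N) where

  fragment-inside : ∀ y k → y + k ≤ N → fragment S (β + y) k ≡ applyUpTo (λ i → f (y + i)) k
  fragment-inside y k y+k≤N = begin
    take k (drop (β + y ∸ 1) (toList S))                 ≡⟨ cong (λ m → take k (drop m (toList S))) (+-∸-comm y 1≤β) ⟩
    take k (drop (β ∸ 1 + y) (toList S))                 ≡⟨ cong (take k) (drop-drop (β ∸ 1) y (toList S)) ⟨
    take k (drop y (drop (β ∸ 1) (toList S)))            ≡⟨ take-drop-take k y N _ y+k≤N ⟨
    take k (drop y (fragment S β N))                     ≡⟨ cong (take k ∘ drop y) S≡f ⟩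
    take k (drop y (applyUpTo f N))                      ≡⟨ take-drop-applyUpTo f y k N y+k≤N ⟩
    applyUpTo (λ i → f (y + i)) k                        ∎
    where open ≡-Reasoning

  fragment-fits : 0 < N → β ∸ 1 + N ≤ n
  fragment-fits 0<N = subst (_≤ n) (+-comm N (β ∸ 1)) (m≤o∸n⇒m+n≤o N (<⇒≤ β∸1<n) N≤)
    where
      N≤ : N ≤ n ∸ (β ∸ 1)
      N≤ = begin
        N                                          ≡⟨ length-applyUpTo f N ⟨
        length (applyUpTo f N)                     ≡⟨ cong length S≡f ⟨
        length (fragment S β N)                    ≡⟨ length-take N _ ⟩
        N ⊓ length (drop (β ∸ 1) (toList S))       ≤⟨ m⊓n≤n N _ ⟩
        length (drop (β ∸ 1) (toList S))           ≡⟨ length-drop (β ∸ 1) (toList S) ⟩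
        length (toList S) ∸ (β ∸ 1)                ≡⟨ cong (_∸ (β ∸ 1)) (length-toList S) ⟩
        n ∸ (β ∸ 1)                                ∎
        where open ≤-Reasoning
      β∸1<n : β ∸ 1 < n
      β∸1<n = m∸n≢0⇒n<m (λ eq → <⇒≱ 0<N (subst (N ≤_) eq N≤))

module Periodic {A : Set} (a b : A) (t : ℕ) where

  L : ℕ
  L = 2 + 2 * t

  ab : Parity → A
  ab 0ℙ = a
  ab 1ℙ = b

  letter : ℕ → A
  letter r with r <? 2 * t
  ... | yes _ = ab (parity r)
  ... | no _  = b

  letter-prefix : ∀ {r} → r < 2 * t → letter r ≡ ab (parity r)
  letter-prefix {r} r<2t with r <? 2 * t
  ... | yes _  = refl
  ... | no r≮ = contradiction r<2t r≮

  letter-suffix : ∀ {r} → 2 * t ≤ r → letter r ≡ b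
  letter-suffix {r} 2t≤r with r <? 2 * t
  ... | yes r<2t = contradiction 2t≤r (<⇒≱ r<2t)
  ... | no _     = refl

  applyUpTo-ab : ∀ m → applyUpTo (λ i → ab (parity i)) (2 * m) ≡ concat (replicate m (a ∷ b ∷ []))
  applyUpTo-ab zero    = refl
  applyUpTo-ab (suc m) = trans (cong (applyUpTo (λ i → ab (parity i))) (*-suc 2 m))
                               (cong (λ xs → a ∷ b ∷ xs) (applyUpTo-ab m))

  applyUpTo-letter : applyUpTo letter L ≡ Tword a b t
  applyUpTo-letter = begin
    applyUpTo letter (2 + 2 * t)                               ≡⟨ cong (applyUpTo letter) (+-comm 2 (2 * t)) ⟩
    applyUpTo letter (2 * t + 2)                               ≡⟨ applyUpTo-++ letter (2 * t) 2 ⟩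
    applyUpTo letter (2 * t) ++ letter (2 * t + 0) ∷ letter (2 * t + 1) ∷ []
      ≡⟨ cong₂ _++_ (applyUpTo-cong (2 * t) (λ _ → letter-prefix))
                    (cong₂ (λ x y → x ∷ y ∷ []) (letter-suffix (m≤m+n _ 0)) (letter-suffix (m≤m+n _ 1))) ⟩
    applyUpTo (λ i → ab (parity i)) (2 * t) ++ b ∷ b ∷ []       ≡⟨ cong (_++ b ∷ b ∷ []) (applyUpTo-ab t) ⟩
    Tword a b t                                                ∎
    where open ≡-Reasoning

  Tω : ℕ → A
  Tω y = letter (y % L)

  offset-in-block : ∀ q {r} → r < L → (q * L + r) % L ≡ r
  offset-in-block q {r} r<L = begin
    (q * L + r) % L   ≡⟨ cong (_% L) (+-comm (q * L) r) ⟩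
    (r + q * L) % L   ≡⟨ [m+kn]%n≡m%n r q L ⟩
    r % L             ≡⟨ m<n⇒m%n≡m r<L ⟩
    r                 ∎
    where open ≡-Reasoning

  Tω-block : ∀ q {r} → r < L → Tω (q * L + r) ≡ letter r
  Tω-block q r<L = cong letter (offset-in-block q r<L)

  Tω-+% : ∀ y i → Tω (y + i) ≡ Tω (y % L + i)
  Tω-+% y i = cong letter (begin
    (y + i) % L                  ≡⟨ %-distribˡ-+ y i L ⟩
    (y % L + i % L) % L          ≡⟨ cong (λ z → (z + i % L) % L) (m%n%n≡m%n y L) ⟨
    (y % L % L + i % L) % L      ≡⟨ %-distribˡ-+ (y % L) i L ⟨
    (y % L + i) % L              ∎)
    where open ≡-Reasoning

  Tω-< : ∀ {z} → z < L → Tω z ≡ letter z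
  Tω-< = Tω-block 0

  Tω-L+ : ∀ z → Tω (L + z) ≡ Tω z
  Tω-L+ z = cong letter (trans (cong (_% L) (+-comm L z)) ([m+n]%n≡m%n z L))

  applyUpTo-Tω : ∀ q → applyUpTo Tω (q * L) ≡ concat (replicate q (Tword a b t))
  applyUpTo-Tω zero    = refl
  applyUpTo-Tω (suc q) = begin
    applyUpTo Tω (L + q * L)                                ≡⟨ applyUpTo-++ Tω L (q * L) ⟩
    applyUpTo Tω L ++ applyUpTo (λ i → Tω (L + i)) (q * L)  ≡⟨ cong₂ _++_ first-block (applyUpTo-cong (q * L) (λ i _ → Tω-L+ i)) ⟩
    Tword a b t ++ applyUpTo Tω (q * L)                     ≡⟨ cong (Tword a b t ++_) (applyUpTo-Tω q) ⟩
    Tword a b t ++ concat (replicate q (Tword a b t))       ∎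
    where
      open ≡-Reasoning
      first-block : applyUpTo Tω L ≡ Tword a b t
      first-block = trans (applyUpTo-cong L (λ _ → Tω-<)) applyUpTo-letter

  2t<L : 2 * t < L
  2t<L = m<n+m (2 * t) {2} (s≤s z≤n)

  Tω-prefix : ∀ {z} → z < 2 * t → Tω z ≡ ab (parity z)
  Tω-prefix z<2t = trans (Tω-< (<-trans z<2t 2t<L)) (letter-prefix z<2t)

  Tω-even : ∀ {z} → z < 2 * t → parity z ≡ 0ℙ → Tω z ≡ a
  Tω-even z<2t even = trans (Tω-prefix z<2t) (cong ab even)

  Tω-odd : ∀ {z} → z < L → parity z ≡ 1ℙ → Tω z ≡ b
  Tω-odd {z} z<L odd with z <? 2 * t
  ... | yes z<2t = trans (Tω-prefix z<2t) (cong ab odd)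
  ... | no z≮2t  = trans (Tω-< z<L) (letter-suffix (≮⇒≥ z≮2t))

  Tω-2t : Tω (2 * t) ≡ b
  Tω-2t = trans (Tω-< 2t<L) (letter-suffix ≤-refl)

  Tω-2t+1 : Tω (2 * t + 1) ≡ b
  Tω-2t+1 = Tω-odd (subst (_< L) (+-comm 1 (2 * t)) (n<1+n (suc (2 * t))))
                   (trans (cong parity (+-comm (2 * t) 1)) (parity-1+2* t))

  Tω-2t+2 : 0 < 2 * t → Tω (2 * t + 2) ≡ a
  Tω-2t+2 0<2t = trans (cong Tω (trans (+-comm (2 * t) 2) (sym (+-identityʳ L)))) (trans (Tω-L+ 0) (Tω-prefix 0<2t))

  data Offset (r : ℕ) : Set where
    even-offset  : r < 2 * t → parity r ≡ 0ℙ → Offset r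
    odd-offset   : r < 2 * t → parity r ≡ 1ℙ → Offset r
    defect-offset : r ≡ 2 * t → Offset r

  offset : ∀ {r} → r ≤ 2 * t → Offset r
  offset {r} r≤2t with r <? 2 * t | parity r in parity-r
  ... | yes r<2t | 0ℙ = even-offset r<2t parity-r
  ... | yes r<2t | 1ℙ = odd-offset r<2t parity-r
  ... | no r≮2t  | _  = defect-offset (≤-antisym r≤2t (≮⇒≥ r≮2t))

  Tω-agree : ∀ {r r'} i → parity r ≡ parity r' → r + i < 2 * t → r' + i < 2 * t → Tω (r + i) ≡ Tω (r' + i)
  Tω-agree {r} {r'} i eq r+i<2t r'+i<2t =
    trans (Tω-prefix r+i<2t) (trans (cong ab (parity-+-cong {r} {r'} i eq)) (sym (Tω-prefix r'+i<2t)))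

  defect-difference : ∀ r r' {d} → parity r ≡ parity r' → r < r' → r' + d ≡ 2 * t →
                      (∀ i → i < d → Tω (r + i) ≡ Tω (r' + i)) × Tω (r + d) ≡ a × Tω (r' + d) ≡ b
  defect-difference r r' {d} eq r<r' r'+d≡2t =
    (λ i i<d → Tω-agree {r} {r'} i eq (<-trans (+-monoˡ-< i r<r') (before i<d)) (before i<d)) ,
    trans (Tω-prefix r+d<2t) (cong ab (trans (parity-+-cong {r} {r'} d eq) (trans (cong parity r'+d≡2t) (parity-2* t)))) ,
    trans (cong Tω r'+d≡2t) Tω-2t
    where
      before : ∀ {i} → i < d → r' + i < 2 * t
      before {i} i<d = subst (r' + i <_) r'+d≡2t (+-monoʳ-< r' i<d)
      r+d<2t : r + d < 2 * t
      r+d<2t = subst (r + d <_) r'+d≡2t (+-monoˡ-< d r<r')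

module Kmers {A : Set} {_≺_ : Rel A 0ℓ} (sto : IsStrictTotalOrder _≡_ _≺_) (a b : A) (t k : ℕ) where
  open Periodic a b t public
  open LexOrder sto public

  kmerAt : ℕ → List A
  kmerAt y = applyUpTo (λ i → Tω (y + i)) k

  kmerAt-% : ∀ y → kmerAt y ≡ kmerAt (y % L)
  kmerAt-% y = applyUpTo-cong k (λ i _ → Tω-+% y i)

  kmerAt-≺ₗ : ∀ y z {d} → d < k → (∀ i → i < d → Tω (y + i) ≡ Tω (z + i)) → Tω (y + d) ≺ Tω (z + d) →
              kmerAt y ≺ₗ kmerAt z
  kmerAt-≺ₗ y z = applyUpTo-≺ₗ k

  kmerAt-≺ₗ-head : ∀ y z → 0 < k → Tω y ≺ Tω z → kmerAt y ≺ₗ kmerAt z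
  kmerAt-≺ₗ-head y z 0<k y≺z =
    kmerAt-≺ₗ y z 0<k (λ _ ()) (subst₂ _≺_ (cong Tω (sym (+-identityʳ y))) (cong Tω (sym (+-identityʳ z))) y≺z)

  kmerAt-defect-free : ∀ {r r'} → parity r ≡ parity r' → r + k ≤ 2 * t → r' + k ≤ 2 * t → kmerAt r ≡ kmerAt r'
  kmerAt-defect-free {r} {r'} eq r+k≤ r'+k≤ =
    applyUpTo-cong k (λ i i<k → Tω-agree {r} {r'} i eq (<-≤-trans (+-monoʳ-< r i<k) r+k≤) (<-≤-trans (+-monoʳ-< r' i<k) r'+k≤))

  later-defect-≺ₗ : ∀ {r r'} → a ≺ b → r < r' → r' ≤ 2 * t → parity r ≡ parity r' → 2 * t ∸ r' < k →
                    kmerAt r ≺ₗ kmerAt r'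
  later-defect-≺ₗ {r} {r'} a≺b r<r' r'≤2t same-parity D<k
    with defect-difference r r' same-parity r<r' (m+[n∸m]≡n r'≤2t)
  ... | agree , a-at , b-at = kmerAt-≺ₗ r r' D<k agree (subst₂ _≺_ (sym a-at) (sym b-at) a≺b)

  earlier-defect-≺ₗ : ∀ {r r'} → b ≺ a → r < r' → r' ≤ 2 * t → parity r ≡ parity r' → 2 * t ∸ r' < k →
                      kmerAt r' ≺ₗ kmerAt r
  earlier-defect-≺ₗ {r} {r'} b≺a r<r' r'≤2t same-parity D<k
    with defect-difference r r' same-parity r<r' (m+[n∸m]≡n r'≤2t)
  ... | agree , a-at , b-at = kmerAt-≺ₗ r' r D<k (λ i i<D → sym (agree i i<D)) (subst₂ _≺_ (sym b-at) (sym a-at) b≺a)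

  module Order-a≺b (a≺b : a ≺ b) (0<k : 0 < k) where

    -- K-mers starting with a come first, a later defect being better; all others get key k.
    keyᵃ : ℕ → ℕ
    keyᵃ r with r <? 2 * t | parity r
    ... | yes _ | 0ℙ = k ∸ (2 * t ∸ r)
    ... | _     | _  = k

    keyᵃ≤k : ∀ r → keyᵃ r ≤ k
    keyᵃ≤k r with r <? 2 * t | parity r
    ... | yes _ | 0ℙ = m∸n≤m k (2 * t ∸ r)
    ... | yes _ | 1ℙ = ≤-refl
    ... | no _  | _  = ≤-refl

    keyᵃ<k⇒even : ∀ {r} → keyᵃ r < k → r < 2 * t × parity r ≡ 0ℙ × keyᵃ r ≡ k ∸ (2 * t ∸ r)
    keyᵃ<k⇒even {r} lt with r <? 2 * t | parity r
    ... | yes r<2t | 0ℙ = r<2t , refl , refl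
    ... | yes _    | 1ℙ = contradiction lt (<-irrefl refl)
    ... | no _     | _  = contradiction lt (<-irrefl refl)

    keyᵃ-even : ∀ {r} → r < 2 * t → parity r ≡ 0ℙ → keyᵃ r ≡ k ∸ (2 * t ∸ r)
    keyᵃ-even {r} r<2t even with r <? 2 * t | parity r
    ... | yes _ | 0ℙ = refl
    ... | no r≮ | _  = contradiction r<2t r≮

    keyᵃ-odd : ∀ {r} → parity r ≡ 1ℙ → keyᵃ r ≡ k
    keyᵃ-odd {r} odd with r <? 2 * t | parity r
    ... | yes _ | 1ℙ = refl
    ... | no _  | 1ℙ = refl

    keyᵃ-even<k : ∀ {r} → r < 2 * t → parity r ≡ 0ℙ → keyᵃ r < k
    keyᵃ-even<k r<2t even = subst (_< k) (sym (keyᵃ-even r<2t even)) (m∸n<m 0<k (m<n⇒0<n∸m r<2t))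

    keyᵃ-mono : ∀ {r r'} → r < 2 * t → parity r ≡ 0ℙ → r ≤ r' → keyᵃ r ≤ keyᵃ r'
    keyᵃ-mono {r} {r'} r<2t even r≤r' with r' <? 2 * t | parity r' in parity-r'
    ... | yes r'<2t | 0ℙ = subst (_≤ k ∸ (2 * t ∸ r')) (sym (keyᵃ-even r<2t even)) (∸-monoʳ-≤ k (∸-monoʳ-≤ (2 * t) r≤r'))
    ... | yes _     | 1ℙ = keyᵃ≤k r
    ... | no _      | _  = keyᵃ≤k r

    keyᵃ-0 : k ≤ 2 * t → keyᵃ 0 ≡ 0
    keyᵃ-0 k≤2t = trans (keyᵃ-even (<-≤-trans 0<k k≤2t) refl) (m≤n⇒m∸n≡0 k≤2t)

    keyᵃ-pos : ∀ {r} → 2 * t < r + k → 0 < keyᵃ r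
    keyᵃ-pos {r} 2t<r+k with r <? 2 * t | parity r
    ... | yes r<2t | 0ℙ = m<n⇒0<n∸m (<+⇒∸< (<⇒≤ r<2t) 2t<r+k)
    ... | yes _    | 1ℙ = 0<k
    ... | no _     | _  = 0<k

    keyᵃ-< : ∀ {r r'} → r < L → r' < L → keyᵃ r < keyᵃ r' → kmerAt r ≺ₗ kmerAt r'
    keyᵃ-< {r} {r'} _ r'<L lt with keyᵃ<k⇒even (<-≤-trans lt (keyᵃ≤k r'))
    ... | r<2t , even , key≡ with r' <? 2 * t | parity r' in parity-r'
    ...   | yes r'<2t | 0ℙ = later-defect-≺ₗ {r} {r'} a≺b (∸-cancelʳ-< D'<D) (<⇒≤ r'<2t) (trans even (sym parity-r')) D'<k
      where
        D'<D : 2 * t ∸ r' < 2 * t ∸ r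
        D'<D = ∸-cancelʳ-< (subst (λ x → x < k ∸ (2 * t ∸ r')) key≡ lt)
        D'<k : 2 * t ∸ r' < k
        D'<k = m∸n≢0⇒n<m {k} (λ eq → n≮0 (subst (keyᵃ r <_) eq lt))
    ...   | yes _     | 1ℙ = kmerAt-≺ₗ-head r r' 0<k (subst₂ _≺_ (sym (Tω-even r<2t even)) (sym (Tω-odd r'<L parity-r')) a≺b)
    ...   | no r'≮2t  | _  = kmerAt-≺ₗ-head r r' 0<k (subst₂ _≺_ (sym (Tω-even r<2t even)) (sym (trans (Tω-< r'<L) (letter-suffix (≮⇒≥ r'≮2t)))) a≺b)

    keyᵃ-≡ : ∀ {r r'} → r < L → r' < L → keyᵃ r ≡ keyᵃ r' → keyᵃ r < k → kmerAt r ≡ kmerAt r'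
    keyᵃ-≡ {r} {r'} _ _ eq lt with keyᵃ<k⇒even lt | keyᵃ<k⇒even (subst (_< k) eq lt)
    ... | r<2t , even , key≡ | r'<2t , even' , key≡' with ∸-≡-cases k (2 * t ∸ r) (2 * t ∸ r') (trans (sym key≡) (trans eq key≡'))
    ...   | inj₁ D≡D' = cong kmerAt (∸-cancelˡ-≡ (<⇒≤ r<2t) (<⇒≤ r'<2t) D≡D')
    ...   | inj₂ (k≤D , k≤D') = kmerAt-defect-free (trans even (sym even')) (+≤ r<2t k≤D) (+≤ r'<2t k≤D')
      where
        +≤ : ∀ {x} → x < 2 * t → k ≤ 2 * t ∸ x → x + k ≤ 2 * t
        +≤ x<2t = ≤∸⇒+≤ (<⇒≤ x<2t)

  module Order-b≺a (b≺a : b ≺ a) (3≤k : 3 ≤ k) (k<2t : k < 2 * t) where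

    -- K-mers starting with b come first, an earlier defect being better; offset 2t (bbab…) ranks
    -- between 2t − 1 (bbba…) and the other odd offsets, and offset 2t + 1 reads like offset 1.
    keyᵇ : ℕ → ℕ
    keyᵇ r with r <? 2 * t | parity r
    ... | yes _ | 0ℙ = suc k
    ... | yes _ | 1ℙ = (2 * t ∸ r) ⊓ k
    ... | no _  | 0ℙ = 2
    ... | no _  | 1ℙ = k

    keyᵇ≤1+k : ∀ r → keyᵇ r ≤ suc k
    keyᵇ≤1+k r with r <? 2 * t | parity r
    ... | yes _ | 0ℙ = ≤-refl
    ... | yes _ | 1ℙ = m≤n⇒m≤1+n (m⊓n≤n (2 * t ∸ r) k)
    ... | no _  | 0ℙ = ≤-trans (≤-trans (n≤1+n 2) 3≤k) (n≤1+n k)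
    ... | no _  | 1ℙ = n≤1+n k

    keyᵇ-odd≤k : ∀ {r} → parity r ≡ 1ℙ → keyᵇ r ≤ k
    keyᵇ-odd≤k {r} odd with r <? 2 * t | parity r
    ... | yes _ | 1ℙ = m⊓n≤n (2 * t ∸ r) k
    ... | no _  | 1ℙ = ≤-refl

    kmerAt-2t+1 : kmerAt (suc (2 * t)) ≡ kmerAt 1
    kmerAt-2t+1 = applyUpTo-cong k same
      where
        same : ∀ i → i < k → Tω (suc (2 * t) + i) ≡ Tω (1 + i)
        same zero    _   = trans (cong Tω (+-identityʳ (suc (2 * t))))
                                 (trans (Tω-odd (n<1+n (suc (2 * t))) (parity-1+2* t)) (sym (Tω-odd (s≤s (s≤s z≤n)) refl)))
        same (suc j) j<k = begin
          Tω (suc (2 * t) + suc j)   ≡⟨ cong (λ x → Tω (suc x)) (+-suc (2 * t) j) ⟩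
          Tω (L + j)                 ≡⟨ Tω-L+ j ⟩
          Tω j                       ≡⟨ Tω-prefix (≤-<-trans (m≤n+m j 2) 2+j<2t) ⟩
          ab (parity j)                ≡⟨ Tω-prefix 2+j<2t ⟨
          Tω (2 + j)                 ∎
          where
            open ≡-Reasoning
            2+j<2t : 2 + j < 2 * t
            2+j<2t = ≤-<-trans j<k k<2t

    keyᵇ-even : ∀ {r} → r < 2 * t → parity r ≡ 0ℙ → keyᵇ r ≡ suc k
    keyᵇ-even {r} r<2t even with r <? 2 * t | parity r
    ... | yes _ | 0ℙ = refl
    ... | no r≮ | _  = contradiction r<2t r≮

    keyᵇ-odd : ∀ {r} → r < 2 * t → parity r ≡ 1ℙ → keyᵇ r ≡ (2 * t ∸ r) ⊓ k
    keyᵇ-odd {r} r<2t odd with r <? 2 * t | parity r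
    ... | yes _ | 1ℙ = refl
    ... | no r≮ | _  = contradiction r<2t r≮

    keyᵇ-2t : keyᵇ (2 * t) ≡ 2
    keyᵇ-2t with 2 * t <? 2 * t | parity (2 * t) in parity-2t
    ... | yes 2t<2t | _  = contradiction 2t<2t (<-irrefl refl)
    ... | no _      | 0ℙ = refl
    ... | no _      | 1ℙ = contradiction (trans (sym parity-2t) (parity-2* t)) λ ()

    keyᵇ-2t+1 : keyᵇ (suc (2 * t)) ≡ k
    keyᵇ-2t+1 with suc (2 * t) <? 2 * t | parity (suc (2 * t)) in parity-2t+1
    ... | yes lt | _  = contradiction lt (<-asym (n<1+n (2 * t)))
    ... | no _   | 1ℙ = refl
    ... | no _   | 0ℙ = contradiction (trans (sym parity-2t+1) (parity-1+2* t)) λ ()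

    keyᵇ-1 : keyᵇ 1 ≡ k
    keyᵇ-1 = trans (keyᵇ-odd 1<2t refl) (m≥n⇒m⊓n≡n (<⇒≤pred k<2t))
      where
        1<2t : 1 < 2 * t
        1<2t = ≤-<-trans (≤-trans (n≤1+n 1) (≤-trans (n≤1+n 2) 3≤k)) k<2t

    0<k : 0 < k
    0<k = ≤-trans (s≤s z≤n) 3≤k

    odd-key≢2 : ∀ {r} → r < 2 * t → parity r ≡ 1ℙ → (2 * t ∸ r) ⊓ k ≢ 2
    odd-key≢2 {r} r<2t odd key≡2 = contradiction (trans (sym odd) even) λ ()
      where
        D≡2 : 2 * t ∸ r ≡ 2
        D≡2 = trans (sym (m⊓n<n⇒m⊓n≡m (subst (_< k) (sym key≡2) 3≤k))) key≡2
        even : parity r ≡ 0ℙ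
        even = trans (cong parity (+-comm 2 r)) (trans (cong parity (trans (cong (r +_) (sym D≡2)) (m+[n∸m]≡n (<⇒≤ r<2t)))) (parity-2* t))

    last-odd≺defect : ∀ {r} → parity r ≡ 1ℙ → r + 1 ≡ 2 * t → kmerAt r ≺ₗ kmerAt (2 * t)
    last-odd≺defect {r} odd r+1≡2t =
      kmerAt-≺ₗ r (2 * t) 3≤k agree (subst₂ _≺_ (sym (trans (cong Tω r+2≡) Tω-2t+1)) (sym (Tω-2t+2 (≤-<-trans z≤n r<2t))) b≺a)
      where
        r<2t : r < 2 * t
        r<2t = subst (r <_) r+1≡2t (m<m+n r (s≤s z≤n))
        r+2≡ : r + 2 ≡ 2 * t + 1
        r+2≡ = trans (+-suc r 1) (trans (cong suc r+1≡2t) (+-comm 1 (2 * t)))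
        agree : ∀ i → i < 2 → Tω (r + i) ≡ Tω (2 * t + i)
        agree zero _ = trans (cong Tω (+-identityʳ r))
                             (trans (Tω-odd (<-trans r<2t 2t<L) odd) (sym (trans (cong Tω (+-identityʳ (2 * t))) Tω-2t)))
        agree (suc zero) _ = trans (cong Tω r+1≡2t) (trans Tω-2t (sym Tω-2t+1))
        agree (suc (suc _)) (s≤s (s≤s ()))

    defect≺odd : ∀ {r} → parity r ≡ 1ℙ → r + 1 < 2 * t → kmerAt (2 * t) ≺ₗ kmerAt r
    defect≺odd {r} odd r+1<2t =
      kmerAt-≺ₗ (2 * t) r (≤-trans (s≤s (s≤s z≤n)) 3≤k) agree (subst₂ _≺_ (sym Tω-2t+1) (sym a-at) b≺a)
      where
        a-at : Tω (r + 1) ≡ a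
        a-at = Tω-even r+1<2t (trans (+-homo-+ r 1) (cong (ℙ._+ 1ℙ) odd))
        agree : ∀ i → i < 1 → Tω (2 * t + i) ≡ Tω (r + i)
        r<L : r < L
        r<L = <-trans (<-trans (n<1+n r) (subst (_< 2 * t) (+-comm r 1) r+1<2t)) 2t<L
        agree zero _ = trans (cong Tω (+-identityʳ (2 * t)))
                             (trans Tω-2t (sym (trans (cong Tω (+-identityʳ r)) (Tω-odd r<L odd))))
        agree (suc _) (s≤s ())

    keyᵇ-<′ : ∀ {r r'} → Offset r → Offset r' → keyᵇ r < keyᵇ r' → kmerAt r ≺ₗ kmerAt r'
    keyᵇ-<′ {r} {r'} (even-offset r<2t even) _ lt =
      contradiction (subst (_< keyᵇ r') (keyᵇ-even r<2t even) lt) (≤⇒≯ (keyᵇ≤1+k r'))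
    keyᵇ-<′ {r} {r'} (odd-offset r<2t odd) (even-offset r'<2t even) _ =
      kmerAt-≺ₗ-head r r' 0<k (subst₂ _≺_ (sym (Tω-odd (<-trans r<2t 2t<L) odd)) (sym (Tω-even r'<2t even)) b≺a)
    keyᵇ-<′ {r} {r'} (odd-offset r<2t odd) (odd-offset r'<2t odd') lt =
      earlier-defect-≺ₗ {r'} {r} b≺a (∸-cancelʳ-< (<-≤-trans D<D'⊓k (m⊓n≤m _ k))) (<⇒≤ r<2t) (trans odd' (sym odd))
                        (<-≤-trans D<D'⊓k (m⊓n≤n _ k))
      where
        lt' : (2 * t ∸ r) ⊓ k < (2 * t ∸ r') ⊓ k
        lt' = subst₂ _<_ (keyᵇ-odd r<2t odd) (keyᵇ-odd r'<2t odd') lt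
        D<D'⊓k : 2 * t ∸ r < (2 * t ∸ r') ⊓ k
        D<D'⊓k = subst (_< _) (m⊓n<n⇒m⊓n≡m (<-≤-trans lt' (m⊓n≤n _ k))) lt'
    keyᵇ-<′ {r} (odd-offset r<2t odd) (defect-offset refl) lt = last-odd≺defect odd r+1≡2t
      where
        lt' : (2 * t ∸ r) ⊓ k < 2
        lt' = subst₂ _<_ (keyᵇ-odd r<2t odd) keyᵇ-2t lt
        D<2 : 2 * t ∸ r < 2
        D<2 = subst (_< 2) (m⊓n<n⇒m⊓n≡m (<-≤-trans lt' (≤-trans (n≤1+n 2) 3≤k))) lt'
        r+1≡2t : r + 1 ≡ 2 * t
        r+1≡2t = trans (cong (r +_) (≤-antisym (m<n⇒0<n∸m r<2t) (≤-pred D<2))) (m+[n∸m]≡n (<⇒≤ r<2t))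
    keyᵇ-<′ {r} {r'} (defect-offset refl) (even-offset r'<2t even) _ =
      kmerAt-≺ₗ-head r r' 0<k (subst₂ _≺_ (sym Tω-2t) (sym (Tω-even r'<2t even)) b≺a)
    keyᵇ-<′ {r} {r'} (defect-offset refl) (odd-offset r'<2t odd) lt =
      defect≺odd odd (<∸⇒+< (<⇒≤ r'<2t) (<-trans (s≤s (s≤s z≤n)) 2<D))
      where
        2<D : 2 < 2 * t ∸ r'
        2<D = <-≤-trans (subst (_< _) keyᵇ-2t (subst (keyᵇ (2 * t) <_) (keyᵇ-odd r'<2t odd) lt)) (m⊓n≤m _ k)
    keyᵇ-<′ (defect-offset refl) (defect-offset refl) lt = contradiction lt (<-irrefl refl)

    keyᵇ-≡′ : ∀ {r r'} → Offset r → Offset r' → keyᵇ r ≡ keyᵇ r' → keyᵇ r < suc k → kmerAt r ≡ kmerAt r'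
    keyᵇ-≡′ (even-offset r<2t even) _ _ lt = contradiction (subst (_< suc k) (keyᵇ-even r<2t even) lt) (<-irrefl refl)
    keyᵇ-≡′ {r} {r'} (odd-offset r<2t odd) (even-offset r'<2t even) eq _ =
      contradiction (subst (_≤ k) (trans eq (keyᵇ-even r'<2t even)) (keyᵇ-odd≤k odd)) (<-irrefl refl)
    keyᵇ-≡′ {r} {r'} (odd-offset r<2t odd) (odd-offset r'<2t odd') eq _ with (2 * t ∸ r) ⊓ k <? k
    ... | yes D⊓k<k = cong kmerAt (∸-cancelˡ-≡ (<⇒≤ r<2t) (<⇒≤ r'<2t)
                        (trans (sym (m⊓n<n⇒m⊓n≡m D⊓k<k)) (trans eq' (m⊓n<n⇒m⊓n≡m (subst (_< k) eq' D⊓k<k)))))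
      where
        eq' : (2 * t ∸ r) ⊓ k ≡ (2 * t ∸ r') ⊓ k
        eq' = trans (sym (keyᵇ-odd r<2t odd)) (trans eq (keyᵇ-odd r'<2t odd'))
    ... | no D⊓k≮k = kmerAt-defect-free (trans odd (sym odd')) (defect-free r<2t (≮⇒≥ D⊓k≮k)) (defect-free r'<2t (subst (k ≤_) eq' (≮⇒≥ D⊓k≮k)))
      where
        eq' : (2 * t ∸ r) ⊓ k ≡ (2 * t ∸ r') ⊓ k
        eq' = trans (sym (keyᵇ-odd r<2t odd)) (trans eq (keyᵇ-odd r'<2t odd'))
        defect-free : ∀ {x} → x < 2 * t → k ≤ (2 * t ∸ x) ⊓ k → x + k ≤ 2 * t
        defect-free x<2t k≤ = ≤∸⇒+≤ (<⇒≤ x<2t) (≤-trans k≤ (m⊓n≤m _ k))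
    keyᵇ-≡′ (odd-offset r<2t odd) (defect-offset refl) eq _ =
      ⊥-elim (odd-key≢2 r<2t odd (trans (sym (keyᵇ-odd r<2t odd)) (trans eq keyᵇ-2t)))
    keyᵇ-≡′ (defect-offset refl) (even-offset r'<2t even) eq _ =
      contradiction (trans (sym keyᵇ-2t) (trans eq (keyᵇ-even r'<2t even))) (<⇒≢ (s≤s (≤-trans (n≤1+n 2) 3≤k)))
    keyᵇ-≡′ (defect-offset refl) (odd-offset r'<2t odd) eq _ =
      ⊥-elim (odd-key≢2 r'<2t odd (trans (sym (keyᵇ-odd r'<2t odd)) (trans (sym eq) keyᵇ-2t)))
    keyᵇ-≡′ (defect-offset refl) (defect-offset refl) _ _ = refl

    record Representative (r : ℕ) : Set where
      field
        r₀ : ℕ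
        offset₀ : Offset r₀
        kmer≡ : kmerAt r ≡ kmerAt r₀
        key≡ : keyᵇ r ≡ keyᵇ r₀

    representative : ∀ {r} → r < L → Representative r
    representative {r} r<L with r ≤? 2 * t
    ... | yes r≤2t = record { r₀ = r ; offset₀ = offset r≤2t ; kmer≡ = refl ; key≡ = refl }
    ... | no r≰2t with ≤-antisym (≤-pred r<L) (≰⇒> r≰2t)
    ...   | refl = record { r₀ = 1 ; offset₀ = odd-offset 1<2t refl ; kmer≡ = kmerAt-2t+1 ; key≡ = trans keyᵇ-2t+1 (sym keyᵇ-1) }
      where
        1<2t : 1 < 2 * t
        1<2t = ≤-<-trans (≤-trans (n≤1+n 1) (≤-trans (n≤1+n 2) 3≤k)) k<2t

    keyᵇ-< : ∀ {r r'} → r < L → r' < L → keyᵇ r < keyᵇ r' → kmerAt r ≺ₗ kmerAt r'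
    keyᵇ-< {r} {r'} r<L r'<L lt =
      subst₂ _≺ₗ_ (sym (kmer≡ ρ)) (sym (kmer≡ ρ')) (keyᵇ-<′ (offset₀ ρ) (offset₀ ρ') (subst₂ _<_ (key≡ ρ) (key≡ ρ') lt))
      where
        open Representative
        ρ : Representative r
        ρ = representative r<L
        ρ' : Representative r'
        ρ' = representative r'<L

    keyᵇ-≡ : ∀ {r r'} → r < L → r' < L → keyᵇ r ≡ keyᵇ r' → keyᵇ r < suc k → kmerAt r ≡ kmerAt r'
    keyᵇ-≡ {r} {r'} r<L r'<L eq lt =
      trans (kmer≡ ρ) (trans (keyᵇ-≡′ (offset₀ ρ) (offset₀ ρ') (trans (sym (key≡ ρ)) (trans eq (key≡ ρ'))) (subst (_< suc k) (key≡ ρ) lt))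
                             (sym (kmer≡ ρ')))
      where
        open Representative
        ρ : Representative r
        ρ = representative r<L
        ρ' : Representative r'
        ρ' = representative r'<L

    keyᵇ-defective<k : ∀ {r} → r < 2 * t → parity r ≡ 1ℙ → 2 * t < r + k → keyᵇ r < k
    keyᵇ-defective<k r<2t odd 2t<r+k = subst (_< k) (sym (keyᵇ-odd r<2t odd)) (≤-<-trans (m⊓n≤m _ k) (<+⇒∸< (<⇒≤ r<2t) 2t<r+k))

    keyᵇ-leftmost : ∀ {r r'} → r < 2 * t → parity r ≡ 1ℙ → 2 * t < r + k → r' < r → keyᵇ r < keyᵇ r'
    keyᵇ-leftmost {r} {r'} r<2t odd 2t<r+k r'<r with offset (<⇒≤ (<-trans r'<r r<2t))
    ... | even-offset r'<2t even = subst (keyᵇ r <_) (sym (keyᵇ-even r'<2t even)) (s≤s (keyᵇ-odd≤k odd))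
    ... | odd-offset r'<2t odd' = subst₂ _<_ (sym (keyᵇ-odd r<2t odd)) (sym (keyᵇ-odd r'<2t odd'))
                              (≤-<-trans (m⊓n≤m _ k) (⊓-pres-m< (∸-monoʳ-< r'<r (<⇒≤ r<2t)) (<+⇒∸< (<⇒≤ r<2t) 2t<r+k)))
    ... | defect-offset refl = contradiction (<-trans r'<r r<2t) (<-irrefl refl)

  -- Positions are counted from the start of T⁵; the copy of T whose minimizers are counted is [2L, 3L).
  module Windows (w : ℕ) (0<w : 0 < w) (w+k≤2t : w + k ≤ 2 * t) (key : ℕ → ℕ) (K : ℕ)
               (key-< : ∀ {r r'} → r < L → r' < L → key r < key r' → kmerAt r ≺ₗ kmerAt r')
               (key-≡ : ∀ {r r'} → r < L → r' < L → key r ≡ key r' → key r < K → kmerAt r ≡ kmerAt r') where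
    open Minimizers _≺_

    keyAt : ℕ → ℕ
    keyAt y = key (y % L)

    keyAt-block : ∀ q {r} → r < L → keyAt (q * L + r) ≡ key r
    keyAt-block q r<L = cong key (offset-in-block q r<L)

    keyAt-< : ∀ {y z} → keyAt y < keyAt z → kmerAt y ≺ₗ kmerAt z
    keyAt-< {y} {z} lt = subst₂ _≺ₗ_ (sym (kmerAt-% y)) (sym (kmerAt-% z)) (key-< (m%n<n y L) (m%n<n z L) lt)

    keyAt-≼ : ∀ {y z} → keyAt y ≤ keyAt z → keyAt y < K → kmerAt y ≼ kmerAt z
    keyAt-≼ {y} {z} le small with m≤n⇒m<n∨m≡n le
    ... | inj₁ lt = ≺ₗ⇒≼ (keyAt-< {y} {z} lt)
    ... | inj₂ eq = ≼-reflexive (trans (kmerAt-% y) (trans (key-≡ (m%n<n y L) (m%n<n z L) eq small) (sym (kmerAt-% z))))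

    record LeftmostMinimum (x : ℕ) : Set where
      field
        u : ℕ
        u≤x : u ≤ x
        x<u+w : x < u + w
        small : keyAt x < K
        minimal : ∀ y → u ≤ y → y < u + w → keyAt x ≤ keyAt y
        leftmost : ∀ y → u ≤ y → y < x → keyAt x < keyAt y

    record Squeezed (x : ℕ) : Set where
      field
        p q : ℕ
        p<x : p < x
        x<q : x < q
        q≤p+w : q ≤ p + w
        p-small : keyAt p < K
        p≤x : keyAt p ≤ keyAt x
        q<x : keyAt q < keyAt x

    offset-in-block₂ : ∀ {u m y} → 2 * L + u ≤ y → y < 2 * L + m → m ≤ L →
             Σ ℕ λ r' → u ≤ r' × r' < m × keyAt y ≡ key r'
    offset-in-block₂ {u} {m} {y} 2L+u≤y y<2L+m m≤L =
      y ∸ 2 * L ,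
      +-cancelˡ-≤ (2 * L) u _ (subst (2 * L + u ≤_) (sym y≡) 2L+u≤y) ,
      r'<m ,
      trans (cong keyAt (sym y≡)) (keyAt-block 2 (<-≤-trans r'<m m≤L))
      where
        y≡ : 2 * L + (y ∸ 2 * L) ≡ y
        y≡ = m+[n∸m]≡n (≤-trans (m≤m+n (2 * L) u) 2L+u≤y)
        r'<m : y ∸ 2 * L < m
        r'<m = +-cancelˡ-< (2 * L) _ m (subst (_< 2 * L + m) (sym y≡) y<2L+m)

    minimum-inside-block : ∀ {r} u → u ≤ r → r < u + w → u + w ≤ L → key r < K →
                   (∀ r' → u ≤ r' → r' < u + w → key r ≤ key r') →
                   (∀ r' → u ≤ r' → r' < r → key r < key r') →
                   LeftmostMinimum (2 * L + r)
    minimum-inside-block {r} u u≤r r<u+w u+w≤L small minimal leftmost = record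
      { u = 2 * L + u
      ; u≤x = +-monoʳ-≤ (2 * L) u≤r
      ; x<u+w = subst (2 * L + r <_) (sym (+-assoc (2 * L) u w)) (+-monoʳ-< (2 * L) r<u+w)
      ; small = subst (_< K) (sym (keyAt-block 2 r<L)) small
      ; minimal = minimal′
      ; leftmost = leftmost′
      }
      where
        r<L : r < L
        r<L = <-≤-trans r<u+w u+w≤L
        minimal′ : ∀ y → 2 * L + u ≤ y → y < 2 * L + u + w → keyAt (2 * L + r) ≤ keyAt y
        minimal′ y 2L+u≤y y< with offset-in-block₂ 2L+u≤y (subst (y <_) (+-assoc (2 * L) u w) y<) u+w≤L
        ... | r' , u≤r' , r'< , key≡ = subst₂ _≤_ (sym (keyAt-block 2 r<L)) (sym key≡) (minimal r' u≤r' r'<)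
        leftmost′ : ∀ y → 2 * L + u ≤ y → y < 2 * L + r → keyAt (2 * L + r) < keyAt y
        leftmost′ y 2L+u≤y y< with offset-in-block₂ 2L+u≤y y< (<⇒≤ r<L)
        ... | r' , u≤r' , r'< , key≡ = subst₂ _<_ (sym (keyAt-block 2 r<L)) (sym key≡) (leftmost r' u≤r' r'<)

    w+k<L : w + k < L
    w+k<L = ≤-trans (s≤s w+k≤2t) (n≤1+n (suc (2 * t)))

    minimum-across-blocks : ∀ {r} → r < L → key r < K →
                 (∀ r' → r ≤ r' → r' < L → key r ≤ key r') →
                 (∀ r' → L + r' < r + w → key r ≤ key r') →
                 LeftmostMinimum (2 * L + r)
    minimum-across-blocks {r} r<L small in-block₂ in-block₃ = record
      { u = 2 * L + r
      ; u≤x = ≤-refl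
      ; x<u+w = m<m+n (2 * L + r) 0<w
      ; small = subst (_< K) (sym (keyAt-block 2 r<L)) small
      ; minimal = minimal′
      ; leftmost = λ y 2L+r≤y y<2L+r → contradiction y<2L+r (≤⇒≯ 2L+r≤y)
      }
      where
        minimal′ : ∀ y → 2 * L + r ≤ y → y < 2 * L + r + w → keyAt (2 * L + r) ≤ keyAt y
        minimal′ y 2L+r≤y y<2L+r+w with y <? 3 * L
        ... | yes y<3L with offset-in-block₂ 2L+r≤y (subst (y <_) (+-comm L (2 * L)) y<3L) ≤-refl
        ...   | r' , r≤r' , r'<L , key≡ = subst₂ _≤_ (sym (keyAt-block 2 r<L)) (sym key≡) (in-block₂ r' r≤r' r'<L)
        minimal′ y 2L+r≤y y<2L+r+w | no y≮3L =
          subst₂ _≤_ (sym (keyAt-block 2 r<L)) (sym (trans (cong keyAt (sym y≡)) (keyAt-block 3 r'<L))) (in-block₃ r' L+r'<r+w)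
          where
            r' : ℕ
            r' = y ∸ 3 * L
            y≡ : 3 * L + r' ≡ y
            y≡ = m+[n∸m]≡n (≮⇒≥ y≮3L)
            L+r'<r+w : L + r' < r + w
            L+r'<r+w = +-cancelˡ-< (2 * L) (L + r') (r + w)
                         (subst₂ _<_ (trans (sym y≡) (trans (cong (_+ r') (+-comm L (2 * L))) (+-assoc (2 * L) L r')))
                                     (+-assoc (2 * L) r w) y<2L+r+w)
            r'<L : r' < L
            r'<L = +-cancelˡ-< L r' L (<-trans L+r'<r+w (+-mono-< r<L (≤-<-trans (m≤m+n w k) w+k<L)))

    module CentralBlock {n : ℕ} (S : Vec A n) (s : ℕ) (2L<s : 2 * L < s)
                   (T⁵ : fragment S (s ∸ 2 * L) (5 * L) ≡ concat (replicate 5 (Tword a b t)))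
                   (offsets : List ℕ)
                   (offset<L : ∀ {r} → r ∈ offsets → r < L)
                   (offset-minimum : ∀ {r} → r ∈ offsets → LeftmostMinimum (2 * L + r))
                   (classify : ∀ {r} → r < L → r ∈ offsets ⊎ Squeezed (2 * L + r)) where

      -- Relative position y is S-position β + y.
      β : ℕ
      β = s ∸ 2 * L

      β+2L≡s : β + 2 * L ≡ s
      β+2L≡s = m∸n+n≡m (<⇒≤ 2L<s)

      1≤β : 1 ≤ β
      1≤β = m<n⇒0<n∸m 2L<s

      S≡Tω : fragment S β (5 * L) ≡ applyUpTo Tω (5 * L)
      S≡Tω = trans T⁵ (sym (applyUpTo-Tω 5))

      fragment≡kmerAt : ∀ {y} → y < 4 * L → fragment S (β + y) k ≡ kmerAt y
      fragment≡kmerAt {y} y<4L = fragment-inside S {f = Tω} 1≤β S≡Tω y k (begin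
        y + k        ≤⟨ +-mono-≤ (<⇒≤ y<4L) (m+n≤o⇒n≤o w (<⇒≤ w+k<L)) ⟩
        4 * L + L    ≡⟨ +-comm (4 * L) L ⟩
        5 * L        ∎)
        where open ≤-Reasoning

      β+5L≤1+n : β + 5 * L ≤ suc n
      β+5L≤1+n = subst (λ z → z + 5 * L ≤ suc n) (trans (+-comm 1 (β ∸ 1)) (m∸n+n≡m 1≤β))
                   (s≤s (fragment-fits S {f = Tω} 1≤β S≡Tω (s≤s z≤n)))

      window-start-valid : ∀ {u} → u < 3 * L → 1 ≤ β + u × β + u ≤ n + 2 ∸ (w + k)
      window-start-valid {u} u<3L = ≤-trans 1≤β (m≤m+n β u) , m+n≤o⇒m≤o∸n (β + u) (begin
        β + u + (w + k)      ≡⟨ +-assoc β u (w + k) ⟩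
        β + (u + (w + k))    ≤⟨ +-monoʳ-≤ β (<⇒≤ (+-mono-< u<3L w+k<L)) ⟩
        β + (3 * L + L)      ≤⟨ +-monoʳ-≤ β (≤-reflexive (+-comm (3 * L) L)) ⟩
        β + 4 * L            ≤⟨ +-monoʳ-≤ β (m≤n+m (4 * L) L) ⟩
        β + 5 * L            ≤⟨ β+5L≤1+n ⟩
        suc n                ≤⟨ n≤1+n (suc n) ⟩
        2 + n                ≡⟨ +-comm 2 n ⟩
        n + 2                ∎)
        where open ≤-Reasoning

      s+r≡β+[2L+r] : ∀ r → s + r ≡ β + (2 * L + r)
      s+r≡β+[2L+r] r = trans (cong (_+ r) (sym β+2L≡s)) (+-assoc β (2 * L) r)

      2L+r<3L : ∀ {r} → r < L → 2 * L + r < 3 * L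
      2L+r<3L {r} r<L = subst (2 * L + r <_) (+-comm (2 * L) L) (+-monoʳ-< (2 * L) r<L)

      within-reach : ∀ {x y} → x < 3 * L → y < x + w → y < 4 * L
      within-reach {x} {y} x<3L y<x+w = <-≤-trans y<x+w (begin
        x + w       ≤⟨ +-mono-≤ (<⇒≤ x<3L) (m+n≤o⇒m≤o w (<⇒≤ w+k<L)) ⟩
        3 * L + L   ≡⟨ +-comm (3 * L) L ⟩
        4 * L       ∎)
        where open ≤-Reasoning

      offset⇒minimizer : ∀ {r} → r ∈ offsets → InM S w k (s + r)
      offset⇒minimizer {r} r∈ = β + u , window-start-valid (≤-<-trans u≤x (2L+r<3L (offset<L r∈))) ,
        subst (IsMinimizer S w k (β + u)) (sym (s+r≡β+[2L+r] r))
          (minimizer-intro sto S w k β u≤x x<u+w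
            (λ y u≤y y<u+w → subst₂ _≼_ (sym (fragment≡kmerAt (reach x<u+w))) (sym (fragment≡kmerAt (reach y<u+w)))
                               (keyAt-≼ {2 * L + r} {y} (minimal y u≤y y<u+w) small))
            (λ y u≤y y<x → subst₂ _≺ₗ_ (sym (fragment≡kmerAt (reach x<u+w))) (sym (fragment≡kmerAt (reach (<-trans y<x x<u+w))))
                             (keyAt-< {2 * L + r} {y} (leftmost y u≤y y<x))))
        where
          open LeftmostMinimum (offset-minimum r∈)
          reach : ∀ {y} → y < u + w → y < 4 * L
          reach y<u+w = within-reach (2L+r<3L (offset<L r∈)) (<-≤-trans y<u+w (+-monoˡ-≤ w u≤x))

      offset-in-central-block : ∀ {x} → s ≤ x → x ≤ s + L ∸ 1 → x ∸ s < L
      offset-in-central-block {x} s≤x x≤s+L-1 =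
        +-cancelˡ-< s (x ∸ s) L (subst (_< s + L) (sym (m+[n∸m]≡n s≤x)) (≤∸1⇒< (≤-trans (s≤s z≤n) (m≤n+m L s)) x≤s+L-1))

      minimizer⇒offset : ∀ {x} → InM S w k x → s ≤ x → x ≤ s + L ∸ 1 → x ∈ map (s +_) offsets
      minimizer⇒offset {x} (i , _ , M) s≤x x≤s+L-1 with classify (offset-in-central-block s≤x x≤s+L-1)
      ... | inj₁ r∈ = subst (_∈ map (s +_) offsets) (m+[n∸m]≡n s≤x) (∈-map⁺ (s +_) r∈)
      ... | inj₂ squeezed = ⊥-elim (squeezed⇒¬minimizer sto S w k M′ (+-monoʳ-< β p<x) (+-monoʳ-< β x<q) β+q≤β+p+w p≼x q≺x)
        where
          open Squeezed squeezed
          X : ℕ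
          X = 2 * L + (x ∸ s)
          M′ : IsMinimizer S w k i (β + X)
          M′ = subst (IsMinimizer S w k i) (trans (sym (m+[n∸m]≡n s≤x)) (s+r≡β+[2L+r] (x ∸ s))) M
          X<3L : X < 3 * L
          X<3L = 2L+r<3L (offset-in-central-block s≤x x≤s+L-1)
          β+q≤β+p+w : β + q ≤ β + p + w
          β+q≤β+p+w = subst (β + q ≤_) (sym (+-assoc β p w)) (+-monoʳ-≤ β q≤p+w)
          q<4L : q < 4 * L
          q<4L = within-reach X<3L (≤-<-trans q≤p+w (+-monoˡ-< w p<x))
          X<4L : X < 4 * L
          X<4L = <-trans x<q q<4L
          p≼x : fragment S (β + p) k ≼ fragment S (β + X) k
          p≼x = subst₂ _≼_ (sym (fragment≡kmerAt (<-trans p<x X<4L))) (sym (fragment≡kmerAt X<4L)) (keyAt-≼ {p} {X} p≤x p-small)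
          q≺x : fragment S (β + q) k ≺ₗ fragment S (β + X) k
          q≺x = subst₂ _≺ₗ_ (sym (fragment≡kmerAt q<4L)) (sym (fragment≡kmerAt X<4L)) (keyAt-< {q} {X} q<x)

      minimizer⇔offset : ∀ x → x ∈ map (s +_) offsets ⇔ (InM S w k x × s ≤ x × x ≤ s + L ∸ 1)
      minimizer⇔offset x = mk⇔ to (λ (m , s≤x , x≤) → minimizer⇒offset m s≤x x≤)
        where
          to : x ∈ map (s +_) offsets → InM S w k x × s ≤ x × x ≤ s + L ∸ 1
          to x∈ with ∈-map⁻ (s +_) x∈
          ... | r , r∈ , refl = offset⇒minimizer r∈ , m≤m+n s r , <⇒≤∸1 (+-monoʳ-< s (offset<L r∈))

      minimizer-count : Unique offsets → HasCount (λ x → InM S w k x × s ≤ x × x ≤ s + L ∸ 1) (length offsets)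
      minimizer-count unique = map (s +_) offsets , length-map (s +_) offsets , Unique.map⁺ (+-cancelˡ-≡ s _ _) unique , minimizer⇔offset

module Count-a≺b {A : Set} {_≺_ : Rel A 0ℓ} (sto : IsStrictTotalOrder _≡_ _≺_) (a b : A) {t k w W : ℕ}
                       (a≺b : a ≺ b) (4≤w : 4 ≤ w) (w≤1+k : w ≤ suc k) (w+k≤2t : w + k ≤ 2 * t)
                       (2W≤w : 2 * W ≤ w) (w≤1+2W : w ≤ suc (2 * W)) where
  open Kmers sto a b t k

  0<w : 0 < w
  0<w = ≤-trans (s≤s z≤n) 4≤w

  0<k : 0 < k
  0<k = ≤-trans (s≤s z≤n) (≤-pred (≤-trans 4≤w w≤1+k))

  k≤2t : k ≤ 2 * t
  k≤2t = m+n≤o⇒n≤o w w+k≤2t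

  open Order-a≺b a≺b 0<k
  open Windows w 0<w w+k≤2t keyᵃ k keyᵃ-< keyᵃ-≡

  offsetsᵃ : List ℕ
  offsetsᵃ = applyUpTo (2 *_) (t + 2 ∸ W)

  fitsᵃ : ∀ {m} → m < t + 2 ∸ W → 2 * m + w ≤ 2 * t + 3
  fitsᵃ {m} m<N = begin
    2 * m + w            ≤⟨ +-monoʳ-≤ (2 * m) w≤1+2W ⟩
    2 * m + suc (2 * W)  ≡⟨ solve (m ∷ W ∷ []) ⟩
    1 + 2 * (W + m)      ≤⟨ s≤s (*-monoʳ-≤ 2 (≤-pred (subst (suc (W + m) ≤_) (+-suc t 1) W+m<t+2))) ⟩
    1 + 2 * (t + 1)      ≡⟨ solve (t ∷ []) ⟩
    2 * t + 3            ∎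
    where
      open ≤-Reasoning
      W+m<t+2 : W + m < t + 2
      W+m<t+2 = <∸⇒+< (<⇒≤ (m∸n≢0⇒n<m (λ eq → n≮0 (subst (m <_) eq m<N)))) m<N

  overflowsᵃ : ∀ {m} → t + 2 ∸ W ≤ m → 2 * t + 4 ≤ 2 * m + w
  overflowsᵃ {m} N≤m = begin
    2 * t + 4            ≡⟨ solve (t ∷ []) ⟩
    2 * (t + 2)          ≤⟨ *-monoʳ-≤ 2 (≤-trans (m≤n+m∸n (t + 2) W) (+-monoʳ-≤ W N≤m)) ⟩
    2 * (W + m)          ≡⟨ solve (W ∷ m ∷ []) ⟩
    2 * W + 2 * m        ≤⟨ +-monoˡ-≤ (2 * m) 2W≤w ⟩
    w + 2 * m            ≡⟨ +-comm w (2 * m) ⟩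
    2 * m + w            ∎
    where open ≤-Reasoning

  w≤L : w ≤ L
  w≤L = ≤-trans (m≤m+n w k) (≤-trans w+k≤2t (m≤n+m (2 * t) 2))

  fits⇒<2t : ∀ {r} → r + w ≤ 2 * t + 3 → r < 2 * t
  fits⇒<2t {r} fits = +-cancelʳ-≤ 3 (suc r) (2 * t) (≤-trans (≤-reflexive (sym (+-suc r 3))) (≤-trans (+-monoʳ-≤ r 4≤w) fits))

  minimum-at-block-start : LeftmostMinimum (2 * L + 0)
  minimum-at-block-start =
    minimum-inside-block 0 z≤n 0<w w≤L (subst (_< k) (sym key0) 0<k) (λ r' _ _ → subst (_≤ keyᵃ r') (sym key0) z≤n) (λ _ _ ())
    where
      key0 : keyᵃ 0 ≡ 0
      key0 = keyᵃ-0 k≤2t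

  minimum-at-even : ∀ m → 2 + 2 * m + w ≤ 2 * t + 3 → LeftmostMinimum (2 * L + (2 + 2 * m))
  minimum-at-even m fits = minimum-inside-block (1 + 2 * m) (n≤1+n _) r<u+w u+w≤L (keyᵃ-even<k r<2t even) minimal leftmost
    where
      r : ℕ
      r = 2 + 2 * m
      even : parity r ≡ 0ℙ
      even = parity-2* m
      r<2t : r < 2 * t
      r<2t = fits⇒<2t fits
      r<u+w : r < 1 + 2 * m + w
      r<u+w = subst (_< 1 + 2 * m + w) (+-comm (1 + 2 * m) 1) (+-monoʳ-< (1 + 2 * m) (≤-trans (s≤s (s≤s z≤n)) 4≤w))
      u+w≤L : 1 + 2 * m + w ≤ L
      u+w≤L = ≤-pred (subst (suc (1 + 2 * m + w) ≤_) (trans (+-comm (2 * t) 3) refl) fits)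
      k-at-u : keyᵃ (1 + 2 * m) ≡ k
      k-at-u = keyᵃ-odd (parity-1+2* m)
      minimal : ∀ r' → 1 + 2 * m ≤ r' → r' < 1 + 2 * m + w → keyᵃ r ≤ keyᵃ r'
      minimal r' u≤r' _ with m≤n⇒m<n∨m≡n u≤r'
      ... | inj₁ r≤r' = keyᵃ-mono r<2t even r≤r'
      ... | inj₂ refl = subst (keyᵃ r ≤_) (sym k-at-u) (keyᵃ≤k r)
      leftmost : ∀ r' → 1 + 2 * m ≤ r' → r' < r → keyᵃ r < keyᵃ r'
      leftmost r' u≤r' r'<r with ≤-antisym u≤r' (≤-pred r'<r)
      ... | refl = subst (keyᵃ r <_) (sym k-at-u) (keyᵃ-even<k r<2t even)

  t₀ : ℕ
  t₀ = pred t

  2t≡2+2t₀ : 2 * t ≡ 2 + 2 * t₀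
  2t≡2+2t₀ = trans (cong (2 *_) (sym (suc-pred t {{>-nonZero 0<t}}))) (*-suc 2 t₀)
    where
      0<t : 0 < t
      0<t = n≢0⇒n>0 (λ t≡0 → <⇒≱ (≤-trans 0<w (m≤m+n w k)) (≤-trans w+k≤2t (≤-reflexive (cong (2 *_) t≡0))))

  2L+L≡3L : 2 * L + L ≡ 3 * L
  2L+L≡3L = +-comm (2 * L) L

  key-at-next-block : keyAt (3 * L) ≡ 0
  key-at-next-block = trans (cong keyAt (sym (+-identityʳ (3 * L)))) (trans (keyAt-block 3 (s≤s z≤n)) (keyᵃ-0 k≤2t))

  squeezed-even : ∀ m → 2 + 2 * m < L → 2 * t + 4 ≤ 2 + 2 * m + w → Squeezed (2 * L + (2 + 2 * m))
  squeezed-even m r<L overflow = record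
    { p = 2 * L + 2 * m
    ; q = 3 * L
    ; p<x = +-monoʳ-< (2 * L) (m<n+m (2 * m) {2} (s≤s z≤n))
    ; x<q = subst (2 * L + (2 + 2 * m) <_) 2L+L≡3L (+-monoʳ-< (2 * L) r<L)
    ; q≤p+w = begin
        3 * L              ≡⟨ 2L+L≡3L ⟨
        2 * L + L          ≤⟨ +-monoʳ-≤ (2 * L) L≤ ⟩
        2 * L + (2 * m + w) ≡⟨ +-assoc (2 * L) (2 * m) w ⟨
        2 * L + 2 * m + w  ∎
    ; p-small = subst (_< k) (sym (keyAt-block 2 p<L)) (keyᵃ-even<k 2m<2t (parity-2* m))
    ; p≤x = subst₂ _≤_ (sym (keyAt-block 2 p<L)) (sym (keyAt-block 2 r<L)) (keyᵃ-mono 2m<2t (parity-2* m) (m≤n+m (2 * m) 2))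
    ; q<x = subst₂ _<_ (sym key-at-next-block) (sym (keyAt-block 2 r<L)) (keyᵃ-pos 2t<r+k)
    }
    where
      open ≤-Reasoning
      L≤ : L ≤ 2 * m + w
      L≤ = ≤-pred (≤-pred (subst (_≤ 2 + 2 * m + w) (+-comm (2 * t) 4) overflow))
      2t<r+k : 2 * t < 2 + 2 * m + k
      2t<r+k = ≤-trans (m≤m+n (suc (2 * t)) 2) (≤-pred (begin
        suc (suc (2 * t) + 2)   ≡⟨ solve (t ∷ []) ⟩
        2 * t + 4               ≤⟨ overflow ⟩
        2 + 2 * m + w           ≤⟨ +-monoʳ-≤ (2 + 2 * m) w≤1+k ⟩
        2 + 2 * m + suc k       ≡⟨ +-suc (2 + 2 * m) k ⟩
        suc (2 + 2 * m + k)     ∎))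
      2m<2t : 2 * m < 2 * t
      2m<2t = +-cancelˡ-< 2 (2 * m) (2 * t) r<L
      p<L : 2 * m < L
      p<L = <-trans 2m<2t 2t<L

  squeezed-overflow : ∀ m → 2 * m < L → 2 * t + 4 ≤ 2 * m + w → Squeezed (2 * L + 2 * m)
  squeezed-overflow zero    _   overflow = contradiction (≤-trans overflow (≤-trans (m≤m+n w k) w+k≤2t)) (m+1+n≰m (2 * t))
  squeezed-overflow (suc m) r<L overflow = subst (λ r → Squeezed (2 * L + r)) (sym (*-suc 2 m))
    (squeezed-even m (subst (_< L) (*-suc 2 m) r<L) (subst (λ r → 2 * t + 4 ≤ r + w) (*-suc 2 m) overflow))

  squeezed-odd : ∀ m → 1 + 2 * m < L → Squeezed (2 * L + (1 + 2 * m))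
  squeezed-odd m r<L with 2 + 2 * m <? 2 * t
  ... | yes 2+2m<2t = record
    { p = 2 * L + 2 * m
    ; q = 2 * L + (2 + 2 * m)
    ; p<x = +-monoʳ-< (2 * L) (n<1+n (2 * m))
    ; x<q = +-monoʳ-< (2 * L) (n<1+n (1 + 2 * m))
    ; q≤p+w = subst (2 * L + (2 + 2 * m) ≤_) (sym (+-assoc (2 * L) (2 * m) w))
                (+-monoʳ-≤ (2 * L) (subst (_≤ 2 * m + w) (+-comm (2 * m) 2) (+-monoʳ-≤ (2 * m) (≤-trans (s≤s (s≤s z≤n)) 4≤w))))
    ; p-small = subst (_< k) (sym (key-at 2m<L)) (keyᵃ-even<k 2m<2t (parity-2* m))
    ; p≤x = subst₂ _≤_ (sym (key-at 2m<L)) (sym (trans (key-at r<L) key-odd)) (keyᵃ≤k (2 * m))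
    ; q<x = subst₂ _<_ (sym (key-at (<-trans 2+2m<2t 2t<L))) (sym (trans (key-at r<L) key-odd)) (keyᵃ-even<k 2+2m<2t (parity-2* m))
    }
    where
      key-at : ∀ {r} → r < L → keyAt (2 * L + r) ≡ keyᵃ r
      key-at = keyAt-block 2
      key-odd : keyᵃ (1 + 2 * m) ≡ k
      key-odd = keyᵃ-odd (parity-1+2* m)
      2m<2t : 2 * m < 2 * t
      2m<2t = <-trans (≤-<-trans (n≤1+n (2 * m)) (n<1+n (suc (2 * m)))) 2+2m<2t
      2m<L : 2 * m < L
      2m<L = <-trans 2m<2t 2t<L
  ... | no 2+2m≮2t = record
    { p = 2 * L + 2 * t₀
    ; q = 3 * L
    ; p<x = +-monoʳ-< (2 * L) (s≤s (*-monoʳ-≤ 2 t₀≤m))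
    ; x<q = subst (2 * L + (1 + 2 * m) <_) 2L+L≡3L (+-monoʳ-< (2 * L) r<L)
    ; q≤p+w = begin
        3 * L                 ≡⟨ 2L+L≡3L ⟨
        2 * L + L             ≡⟨ cong (λ z → 2 * L + (2 + z)) 2t≡2+2t₀ ⟩
        2 * L + (4 + 2 * t₀)  ≤⟨ +-monoʳ-≤ (2 * L) (subst (_≤ 2 * t₀ + w) (+-comm (2 * t₀) 4) (+-monoʳ-≤ (2 * t₀) 4≤w)) ⟩
        2 * L + (2 * t₀ + w)  ≡⟨ +-assoc (2 * L) (2 * t₀) w ⟨
        2 * L + 2 * t₀ + w    ∎
    ; p-small = subst (_< k) (sym (keyAt-block 2 2t₀<L)) (keyᵃ-even<k 2t₀<2t (parity-2* t₀))
    ; p≤x = subst₂ _≤_ (sym (keyAt-block 2 2t₀<L)) (sym (trans (keyAt-block 2 r<L) (keyᵃ-odd (parity-1+2* m)))) (keyᵃ≤k (2 * t₀))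
    ; q<x = subst₂ _<_ (sym key-at-next-block) (sym (trans (keyAt-block 2 r<L) (keyᵃ-odd (parity-1+2* m)))) 0<k
    }
    where
      open ≤-Reasoning
      2t₀<2t : 2 * t₀ < 2 * t
      2t₀<2t = subst (2 * t₀ <_) (sym 2t≡2+2t₀) (m<n+m (2 * t₀) {2} (s≤s z≤n))
      2t₀<L : 2 * t₀ < L
      2t₀<L = <-trans 2t₀<2t 2t<L
      t₀≤m : t₀ ≤ m
      t₀≤m = *-cancelˡ-≤ 2 (+-cancelˡ-≤ 2 (2 * t₀) (2 * m) (subst (_≤ 2 + 2 * m) 2t≡2+2t₀ (≮⇒≥ 2+2m≮2t)))

  minimum-at : ∀ m → 2 * m + w ≤ 2 * t + 3 → LeftmostMinimum (2 * L + 2 * m)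
  minimum-at zero    _    = minimum-at-block-start
  minimum-at (suc m) fits = subst (λ r → LeftmostMinimum (2 * L + r)) (sym (*-suc 2 m))
                              (minimum-at-even m (subst (λ r → r + w ≤ 2 * t + 3) (*-suc 2 m) fits))

  offset<L : ∀ {r} → r ∈ offsetsᵃ → r < L
  offset<L r∈ with ∈-applyUpTo⁻ (2 *_) r∈
  ... | m , m<N , refl = <-trans (fits⇒<2t (fitsᵃ m<N)) 2t<L

  offset-minimum : ∀ {r} → r ∈ offsetsᵃ → LeftmostMinimum (2 * L + r)
  offset-minimum r∈ with ∈-applyUpTo⁻ (2 *_) r∈
  ... | m , m<N , refl = minimum-at m (fitsᵃ m<N)

  classify : ∀ {r} → r < L → r ∈ offsetsᵃ ⊎ Squeezed (2 * L + r)
  classify {r} r<L with even-or-odd r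
  ... | inj₂ (m , refl) = inj₂ (squeezed-odd m r<L)
  ... | inj₁ (m , refl) with m <? t + 2 ∸ W
  ...   | yes m<N = inj₁ (∈-applyUpTo⁺ (2 *_) m<N)
  ...   | no m≮N  = inj₂ (squeezed-overflow m r<L (overflowsᵃ (≮⇒≥ m≮N)))

  count : ∀ {n} (S : Vec A n) s → 2 * L < s → fragment S (s ∸ 2 * L) (5 * L) ≡ concat (replicate 5 (Tword a b t)) →
          HasCount (λ x → Minimizers.InM _≺_ S w k x × s ≤ x × x ≤ s + L ∸ 1) (t + 2 ∸ W)
  count S s 2L<s T⁵ = subst (HasCount _) (length-applyUpTo (2 *_) (t + 2 ∸ W))
    (CentralBlock.minimizer-count S s 2L<s T⁵ offsetsᵃ offset<L offset-minimum classify
      (Unique.applyUpTo⁺₁ (2 *_) (t + 2 ∸ W) (λ i<j _ → <⇒≢ (*-monoʳ-< 2 i<j))))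

module Count-b≺a {A : Set} {_≺_ : Rel A 0ℓ} (sto : IsStrictTotalOrder _≡_ _≺_) (a b : A) {t k w W κ : ℕ}
                      (b≺a : b ≺ a) (4≤w : 4 ≤ w) (w≤1+k : w ≤ suc k) (w+k≤2t : w + k ≤ 2 * t)
                      (2W≤w : 2 * W ≤ w) (w≤1+2W : w ≤ suc (2 * W)) (2κ≤k : 2 * κ ≤ k) (k≤1+2κ : k ≤ suc (2 * κ)) where
  open Kmers sto a b t k

  0<w : 0 < w
  0<w = ≤-trans (s≤s z≤n) 4≤w

  3≤k : 3 ≤ k
  3≤k = ≤-pred (≤-trans 4≤w w≤1+k)

  k<2t : k < 2 * t
  k<2t = ≤-trans (+-monoˡ-≤ k 0<w) w+k≤2t

  open Order-b≺a b≺a 3≤k k<2t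
  open Windows w 0<w w+k≤2t keyᵇ (suc k) keyᵇ-< keyᵇ-≡

  -- The odd offsets below 2e + 1 have defect-free k-mers (key k); those from 2e + 1 to 2t − 1 do not.
  e : ℕ
  e = t ∸ κ

  e+κ≡t : e + κ ≡ t
  e+κ≡t = m∸n+n≡m {t} {κ} (*-cancelˡ-≤ 2 (≤-trans 2κ≤k (<⇒≤ k<2t)))

  2e+2κ≡2t : 2 * e + 2 * κ ≡ 2 * t
  2e+2κ≡2t = trans (sym (*-distribˡ-+ 2 e κ)) (cong (2 *_) e+κ≡t)

  0<κ : 0 < κ
  0<κ = n≢0⇒n>0 (λ κ≡0 → <⇒≱ 3≤k (≤-trans (subst (λ z → k ≤ suc (2 * z)) κ≡0 k≤1+2κ) (n≤1+n 1)))

  1+2e<2t : 1 + 2 * e < 2 * t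
  1+2e<2t = subst (1 + 2 * e <_) 2e+2κ≡2t (subst (_≤ 2 * e + 2 * κ) (+-comm (2 * e) 2) (+-monoʳ-≤ (2 * e) (*-monoʳ-≤ 2 0<κ)))

  w≤2e : w ≤ 2 * e
  w≤2e = +-cancelʳ-≤ (2 * κ) w (2 * e) (≤-trans (+-monoʳ-≤ w 2κ≤k) (subst (w + k ≤_) (sym 2e+2κ≡2t) w+k≤2t))

  k≤keyᵇ : ∀ {r} → r + 2 * κ ≤ 2 * t → k ≤ keyᵇ r
  k≤keyᵇ {r} r+2κ≤2t with offset (m+n≤o⇒m≤o r r+2κ≤2t)
  ... | even-offset r<2t even = subst (k ≤_) (sym (keyᵇ-even r<2t even)) (n≤1+n k)
  ... | odd-offset r<2t odd = subst (k ≤_) (sym (keyᵇ-odd r<2t odd)) (⊓-glb (≤∸ r+k≤2t) ≤-refl)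
    where
      odd+even : parity (r + 2 * κ) ≡ 1ℙ
      odd+even = trans (+-homo-+ r (2 * κ)) (cong₂ ℙ._+_ odd (parity-2* κ))
      r+2κ<2t : r + 2 * κ < 2 * t
      r+2κ<2t = ≤∧≢⇒< r+2κ≤2t (λ eq → contradiction (trans (sym (parity-2* t)) (trans (sym (cong parity eq)) odd+even)) λ ())
      r+k≤2t : r + k ≤ 2 * t
      r+k≤2t = ≤-trans (+-monoʳ-≤ r k≤1+2κ) (subst (_≤ 2 * t) (sym (+-suc r (2 * κ))) r+2κ<2t)
      ≤∸ : r + k ≤ 2 * t → k ≤ 2 * t ∸ r
      ≤∸ le = m+n≤o⇒m≤o∸n k (subst (_≤ 2 * t) (+-comm r k) le)
  ... | defect-offset refl = contradiction r+2κ≤2t (λ le → <⇒≱ (m<m+n (2 * t) (≤-trans (s≤s z≤n) (*-monoʳ-≤ 2 0<κ))) le)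

  defect-free-offsets : List ℕ
  defect-free-offsets = applyUpTo (λ m → 1 + 2 * m) (e + 1 ∸ W)

  defective-offsets : List ℕ
  defective-offsets = applyUpTo (λ j → 1 + 2 * (e + j)) κ

  offsetsᵇ : List ℕ
  offsetsᵇ = defect-free-offsets ++ defective-offsets ++ 2 * t ∷ 1 + 2 * t ∷ []

  fitsᵇ : ∀ {m} → m < e + 1 ∸ W → 2 * m + w ≤ 1 + 2 * e
  fitsᵇ {m} m<N = begin
    2 * m + w            ≤⟨ +-monoʳ-≤ (2 * m) w≤1+2W ⟩
    2 * m + suc (2 * W)  ≡⟨ solve (m ∷ W ∷ []) ⟩
    1 + 2 * (W + m)      ≤⟨ s≤s (*-monoʳ-≤ 2 (≤-pred (subst (suc (W + m) ≤_) (+-comm e 1) W+m<e+1))) ⟩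
    1 + 2 * e            ∎
    where
      open ≤-Reasoning
      W+m<e+1 : W + m < e + 1
      W+m<e+1 = <∸⇒+< (<⇒≤ (m∸n≢0⇒n<m (λ eq → n≮0 (subst (m <_) eq m<N)))) m<N

  overflowsᵇ : ∀ {m} → e + 1 ∸ W ≤ m → 2 + 2 * e ≤ 2 * m + w
  overflowsᵇ {m} N≤m = begin
    2 + 2 * e            ≡⟨ trans (sym (*-suc 2 e)) (cong (2 *_) (+-comm 1 e)) ⟩
    2 * (e + 1)          ≤⟨ *-monoʳ-≤ 2 (≤-trans (m≤n+m∸n (e + 1) W) (+-monoʳ-≤ W N≤m)) ⟩
    2 * (W + m)          ≡⟨ solve (W ∷ m ∷ []) ⟩
    2 * W + 2 * m        ≤⟨ +-monoˡ-≤ (2 * m) 2W≤w ⟩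
    w + 2 * m            ≡⟨ +-comm w (2 * m) ⟩
    2 * m + w            ∎
    where open ≤-Reasoning

  before-defective : ∀ {r} → r ≤ 2 * e → r + 2 * κ ≤ 2 * t
  before-defective {r} r≤2e = subst (r + 2 * κ ≤_) 2e+2κ≡2t (+-monoˡ-≤ (2 * κ) r≤2e)

  minimum-defect-free : ∀ m → 2 * m + w ≤ 1 + 2 * e → LeftmostMinimum (2 * L + (1 + 2 * m))
  minimum-defect-free m fits = minimum-inside-block (2 * m) (n≤1+n _) r<u+w u+w≤L (s≤s key≤k) minimal leftmost
    where
      key≤k : keyᵇ (1 + 2 * m) ≤ k
      key≤k = keyᵇ-odd≤k (parity-1+2* m)
      r<u+w : 1 + 2 * m < 2 * m + w
      r<u+w = subst (_< 2 * m + w) (+-comm (2 * m) 1) (+-monoʳ-< (2 * m) (≤-trans (s≤s (s≤s z≤n)) 4≤w))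
      u+w≤L : 2 * m + w ≤ L
      u+w≤L = ≤-trans fits (<⇒≤ (<-trans 1+2e<2t 2t<L))
      2m<2t : 2 * m < 2 * t
      2m<2t = <-trans (m<m+n (2 * m) 0<w) (≤-<-trans fits 1+2e<2t)
      minimal : ∀ r' → 2 * m ≤ r' → r' < 2 * m + w → keyᵇ (1 + 2 * m) ≤ keyᵇ r'
      minimal r' _ r'<u+w = ≤-trans key≤k (k≤keyᵇ (before-defective (≤-pred (≤-trans r'<u+w fits))))
      leftmost : ∀ r' → 2 * m ≤ r' → r' < 1 + 2 * m → keyᵇ (1 + 2 * m) < keyᵇ r'
      leftmost r' u≤r' r'<r with ≤-antisym u≤r' (≤-pred r'<r)
      ... | refl = subst (keyᵇ (1 + 2 * m) <_) (sym (keyᵇ-even 2m<2t (parity-2* m))) (s≤s key≤k)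

  minimum-defective : ∀ j → j < κ → LeftmostMinimum (2 * L + (1 + 2 * (e + j)))
  minimum-defective j j<κ = minimum-inside-block (suc r ∸ w)
                         (≤-pred (subst (suc r ∸ w <_) (m∸n+n≡m w≤1+r) (m<m+n (suc r ∸ w) 0<w)))
                         r<u+w (subst (_≤ L) (sym (m∸n+n≡m w≤1+r)) (<-trans r<2t 2t<L))
                         (≤-trans (keyᵇ-defective<k r<2t odd 2t<r+k) (n≤1+n k)) minimal (λ r' _ → keyᵇ-leftmost r<2t odd 2t<r+k)
    where
      r : ℕ
      r = 1 + 2 * (e + j)
      odd : parity r ≡ 1ℙ
      odd = parity-1+2* (e + j)
      r<2t : r < 2 * t
      r<2t = begin-strict
        r                      <⟨ n<1+n r ⟩
        suc r                  ≡⟨ rearrange e j ⟩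
        2 * e + 2 * suc j      ≤⟨ +-monoʳ-≤ (2 * e) (*-monoʳ-≤ 2 j<κ) ⟩
        2 * e + 2 * κ          ≡⟨ 2e+2κ≡2t ⟩
        2 * t                  ∎
        where
          open ≤-Reasoning
          rearrange : ∀ x y → suc (1 + 2 * (x + y)) ≡ 2 * x + 2 * suc y
          rearrange x y = solve (x ∷ y ∷ [])
      2t<r+k : 2 * t < r + k
      2t<r+k = begin-strict
        2 * t                  ≡⟨ 2e+2κ≡2t ⟨
        2 * e + 2 * κ          ≤⟨ +-monoʳ-≤ (2 * e) 2κ≤k ⟩
        2 * e + k              ≤⟨ +-monoˡ-≤ k (*-monoʳ-≤ 2 (m≤m+n e j)) ⟩
        2 * (e + j) + k        <⟨ n<1+n _ ⟩
        r + k                  ∎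
        where open ≤-Reasoning
      w≤1+r : w ≤ suc r
      w≤1+r = ≤-trans w≤2e (≤-trans (*-monoʳ-≤ 2 (m≤m+n e j)) (≤-trans (n≤1+n _) (n≤1+n _)))
      r<u+w : r < suc r ∸ w + w
      r<u+w = subst (r <_) (sym (m∸n+n≡m w≤1+r)) (n<1+n r)
      minimal : ∀ r' → suc r ∸ w ≤ r' → r' < suc r ∸ w + w → keyᵇ r ≤ keyᵇ r'
      minimal r' _ r'<u+w with m≤n⇒m<n∨m≡n (≤-pred (subst (r' <_) (m∸n+n≡m w≤1+r) r'<u+w))
      ... | inj₁ r'<r = <⇒≤ (keyᵇ-leftmost r<2t odd 2t<r+k r'<r)
      ... | inj₂ refl = ≤-refl

  next-block : ∀ {r r'} → r < L → L + r' < r + w → k ≤ keyᵇ r'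
  next-block {r} {r'} r<L L+r'<r+w = k≤keyᵇ (begin
    r' + 2 * κ   ≤⟨ +-monoʳ-≤ r' 2κ≤k ⟩
    r' + k       ≤⟨ +-monoˡ-≤ k (<⇒≤ r'<w) ⟩
    w + k        ≤⟨ w+k≤2t ⟩
    2 * t        ∎)
    where
      open ≤-Reasoning
      r'<w : r' < w
      r'<w = +-cancelˡ-< L r' w (<-trans L+r'<r+w (+-monoˡ-< w r<L))

  minimum-defect : LeftmostMinimum (2 * L + 2 * t)
  minimum-defect = minimum-across-blocks 2t<L (subst (_< suc k) (sym keyᵇ-2t) 2<1+k) in-block₂
                     (λ r' L+r'<2t+w → subst (_≤ keyᵇ r') (sym keyᵇ-2t) (≤-trans 2≤k (next-block 2t<L L+r'<2t+w)))
    where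
      2≤k : 2 ≤ k
      2≤k = ≤-trans (n≤1+n 2) 3≤k
      2<1+k : 2 < suc k
      2<1+k = s≤s 2≤k
      in-block₂ : ∀ r' → 2 * t ≤ r' → r' < L → keyᵇ (2 * t) ≤ keyᵇ r'
      in-block₂ r' 2t≤r' r'<L with m≤n⇒m<n∨m≡n 2t≤r'
      ... | inj₂ refl = ≤-refl
      ... | inj₁ 2t<r' with ≤-antisym (≤-pred r'<L) 2t<r'
      ...   | refl = subst₂ _≤_ (sym keyᵇ-2t) (sym keyᵇ-2t+1) 2≤k

  minimum-after-defect : LeftmostMinimum (2 * L + suc (2 * t))
  minimum-after-defect = minimum-across-blocks ≤-refl (subst (_< suc k) (sym keyᵇ-2t+1) (n<1+n k)) in-block₂
                           (λ r' L+r'<r+w → subst (_≤ keyᵇ r') (sym keyᵇ-2t+1) (next-block ≤-refl L+r'<r+w))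
    where
      in-block₂ : ∀ r' → suc (2 * t) ≤ r' → r' < L → keyᵇ (suc (2 * t)) ≤ keyᵇ r'
      in-block₂ r' 2t<r' r'<L with ≤-antisym (≤-pred r'<L) 2t<r'
      ... | refl = ≤-refl

  odd-before : ∀ m → 2 * m < L → Σ ℕ λ p → suc p ≡ 2 * L + 2 * m × keyAt p ≤ k
  odd-before zero    _ =
    1 * L + suc (2 * t) ,
    trans (sym (+-suc (1 * L) (suc (2 * t)))) (trans (+-comm (1 * L) L) (sym (+-identityʳ (2 * L)))) ,
    subst (_≤ k) (sym (keyAt-block 1 ≤-refl)) (keyᵇ-odd≤k (parity-1+2* t))
  odd-before (suc m) 2m<L =
    2 * L + (1 + 2 * m) ,
    trans (sym (+-suc (2 * L) (1 + 2 * m))) (cong (2 * L +_) (sym (*-suc 2 m))) ,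
    subst (_≤ k) (sym (keyAt-block 2 1+2m<L)) (keyᵇ-odd≤k (parity-1+2* m))
    where
      1+2m<L : 1 + 2 * m < L
      1+2m<L = <-trans (n<1+n (1 + 2 * m)) (subst (_< L) (*-suc 2 m) 2m<L)

  squeezed-even : ∀ m → 2 * m < 2 * t → Squeezed (2 * L + 2 * m)
  squeezed-even m 2m<2t with odd-before m (<-trans 2m<2t 2t<L)
  ... | p , 1+p≡x , p≤k = record
    { p = p
    ; q = 2 * L + (1 + 2 * m)
    ; p<x = ≤-reflexive 1+p≡x
    ; x<q = +-monoʳ-< (2 * L) (n<1+n (2 * m))
    ; q≤p+w = subst₂ _≤_ (trans (cong suc 1+p≡x) (sym (+-suc (2 * L) (2 * m)))) (+-comm w p)
                         (+-monoˡ-≤ p (≤-trans (s≤s (s≤s z≤n)) 4≤w))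
    ; p-small = s≤s p≤k
    ; p≤x = ≤-trans p≤k (subst (k ≤_) (sym key-x) (n≤1+n k))
    ; q<x = subst₂ _<_ (sym (keyAt-block 2 1+2m<L)) (sym key-x) (s≤s (keyᵇ-odd≤k (parity-1+2* m)))
    }
    where
      2m<L : 2 * m < L
      2m<L = <-trans 2m<2t 2t<L
      1+2m<L : 1 + 2 * m < L
      1+2m<L = ≤-<-trans 2m<2t 2t<L
      key-x : keyAt (2 * L + 2 * m) ≡ suc k
      key-x = trans (keyAt-block 2 2m<L) (keyᵇ-even 2m<2t (parity-2* m))

  squeezed-defect-free : ∀ m → m < e → 2 + 2 * e ≤ 2 * m + w → Squeezed (2 * L + (1 + 2 * m))
  squeezed-defect-free m m<e overflow with odd-before m (<-trans 2m<2e (<-trans 2e<2t 2t<L))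
    where
      2m<2e : 2 * m < 2 * e
      2m<2e = *-monoʳ-< 2 m<e
      2e<2t : 2 * e < 2 * t
      2e<2t = <-trans (n<1+n (2 * e)) 1+2e<2t
  ... | p , 1+p≡ , p≤k = record
    { p = p
    ; q = 2 * L + (1 + 2 * e)
    ; p<x = ≤-trans (n≤1+n (suc p)) (≤-reflexive x≡)
    ; x<q = +-monoʳ-< (2 * L) (s≤s (*-monoʳ-< 2 m<e))
    ; q≤p+w = ≤-pred (subst₂ _≤_ (+-suc (2 * L) (1 + 2 * e))
                                  (trans (sym (+-assoc (2 * L) (2 * m) w)) (cong (_+ w) (sym 1+p≡)))
                        (+-monoʳ-≤ (2 * L) overflow))
    ; p-small = s≤s p≤k
    ; p≤x = ≤-trans p≤k (subst (k ≤_) (sym key-x) (k≤keyᵇ (before-defective (*-monoʳ-< 2 m<e))))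
    ; q<x = subst₂ _<_ (sym (keyAt-block 2 1+2e<L)) (sym key-x)
              (<-≤-trans (keyᵇ-defective<k 1+2e<2t (parity-1+2* e) 2t<1+2e+k) (k≤keyᵇ (before-defective (*-monoʳ-< 2 m<e))))
    }
    where
      x≡ : suc (suc p) ≡ 2 * L + (1 + 2 * m)
      x≡ = trans (cong suc 1+p≡) (sym (+-suc (2 * L) (2 * m)))
      1+2e<L : 1 + 2 * e < L
      1+2e<L = <-trans 1+2e<2t 2t<L
      1+2m<L : 1 + 2 * m < L
      1+2m<L = <-trans (s≤s (*-monoʳ-< 2 m<e)) 1+2e<L
      key-x : keyAt (2 * L + (1 + 2 * m)) ≡ keyᵇ (1 + 2 * m)
      key-x = keyAt-block 2 1+2m<L
      2t<1+2e+k : 2 * t < 1 + 2 * e + k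
      2t<1+2e+k = s≤s (subst (_≤ 2 * e + k) 2e+2κ≡2t (+-monoʳ-≤ (2 * e) 2κ≤k))

  defective<2t : ∀ {j} → j < κ → 1 + 2 * (e + j) < 2 * t
  defective<2t {j} j<κ = begin-strict
    1 + 2 * (e + j)        <⟨ n<1+n _ ⟩
    2 + 2 * (e + j)        ≡⟨ rearrange e j ⟩
    2 * e + 2 * suc j      ≤⟨ +-monoʳ-≤ (2 * e) (*-monoʳ-≤ 2 j<κ) ⟩
    2 * e + 2 * κ          ≡⟨ 2e+2κ≡2t ⟩
    2 * t                  ∎
    where
      open ≤-Reasoning
      rearrange : ∀ x y → 2 + 2 * (x + y) ≡ 2 * x + 2 * suc y
      rearrange x y = solve (x ∷ y ∷ [])

  defect-free<1+2e : ∀ {v} → v ∈ defect-free-offsets → v < 1 + 2 * e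
  defect-free<1+2e v∈ with ∈-applyUpTo⁻ (λ m → 1 + 2 * m) v∈
  ... | m , m<N , refl =
    s≤s (≤-pred (≤-trans (subst (_≤ 2 * m + w) (+-comm (2 * m) 2) (+-monoʳ-≤ (2 * m) (≤-trans (s≤s (s≤s z≤n)) 4≤w))) (fitsᵇ m<N)))

  defective-bounds : ∀ {v} → v ∈ defective-offsets → 1 + 2 * e ≤ v × v < 2 * t
  defective-bounds v∈ with ∈-applyUpTo⁻ (λ j → 1 + 2 * (e + j)) v∈
  ... | j , j<κ , refl = s≤s (*-monoʳ-≤ 2 (m≤m+n e j)) , defective<2t j<κ

  bb-bounds : ∀ {v} → v ∈ (2 * t ∷ 1 + 2 * t ∷ []) → 2 * t ≤ v × v < L
  bb-bounds (here refl) = ≤-refl , 2t<L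
  bb-bounds (there (here refl)) = n≤1+n (2 * t) , ≤-refl

  offset<L : ∀ {r} → r ∈ offsetsᵇ → r < L
  offset<L r∈ with ∈-++⁻ defect-free-offsets r∈
  ... | inj₁ r∈defect-free = <-trans (<-trans (defect-free<1+2e r∈defect-free) 1+2e<2t) 2t<L
  ... | inj₂ r∈rest with ∈-++⁻ defective-offsets r∈rest
  ...   | inj₁ r∈defective = <-trans (proj₂ (defective-bounds r∈defective)) 2t<L
  ...   | inj₂ r∈bb = proj₂ (bb-bounds r∈bb)

  offset-minimum : ∀ {r} → r ∈ offsetsᵇ → LeftmostMinimum (2 * L + r)
  offset-minimum r∈ with ∈-++⁻ defect-free-offsets r∈
  ... | inj₁ r∈defect-free with ∈-applyUpTo⁻ (λ m → 1 + 2 * m) r∈defect-free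
  ...   | m , m<N , refl = minimum-defect-free m (fitsᵇ m<N)
  offset-minimum r∈ | inj₂ r∈rest with ∈-++⁻ defective-offsets r∈rest
  ... | inj₁ r∈defective with ∈-applyUpTo⁻ (λ j → 1 + 2 * (e + j)) r∈defective
  ...   | j , j<κ , refl = minimum-defective j j<κ
  offset-minimum r∈ | inj₂ r∈rest | inj₂ (here refl) = minimum-defect
  offset-minimum r∈ | inj₂ r∈rest | inj₂ (there (here refl)) = minimum-after-defect

  classify : ∀ {r} → r < L → r ∈ offsetsᵇ ⊎ Squeezed (2 * L + r)
  classify {r} r<L with even-or-odd r
  ... | inj₁ (m , refl) with 2 * m <? 2 * t
  ...   | yes 2m<2t = inj₂ (squeezed-even m 2m<2t)
  ...   | no 2m≮2t  = inj₁ (∈-++⁺ʳ defect-free-offsets (∈-++⁺ʳ defective-offsets (here (cong (2 *_) m≡t))))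
    where
      m≡t : m ≡ t
      m≡t = ≤-antisym (≤-pred (*-cancelˡ-< 2 m (suc t) (subst (2 * m <_) (sym (*-suc 2 t)) r<L)))
                      (*-cancelˡ-≤ 2 (≮⇒≥ 2m≮2t))
  classify {r} r<L | inj₂ (m , refl) with 1 + 2 * m <? 2 * t
  ... | no 1+2m≮2t = inj₁ (∈-++⁺ʳ defect-free-offsets (∈-++⁺ʳ defective-offsets (there (here (cong (λ z → 1 + 2 * z) m≡t)))))
    where
      m≡t : m ≡ t
      m≡t = ≤-antisym (*-cancelˡ-≤ 2 (≤-pred (≤-pred r<L)))
                      (≤-pred (*-cancelˡ-< 2 t (suc m) (subst (2 * t <_) (sym (*-suc 2 m)) (s≤s (≮⇒≥ 1+2m≮2t)))))
  ... | yes 1+2m<2t with e ≤? m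
  ...   | yes e≤m =
    inj₁ (∈-++⁺ʳ defect-free-offsets (∈-++⁺ˡ (subst (_∈ defective-offsets) r≡ (∈-applyUpTo⁺ (λ j → 1 + 2 * (e + j)) j<κ))))
    where
      j<κ : m ∸ e < κ
      j<κ = +-cancelˡ-< e (m ∸ e) κ
              (subst₂ _<_ (sym (m+[n∸m]≡n e≤m)) (sym e+κ≡t) (*-cancelˡ-< 2 m t (<-trans (n<1+n (2 * m)) 1+2m<2t)))
      r≡ : 1 + 2 * (e + (m ∸ e)) ≡ 1 + 2 * m
      r≡ = cong (λ z → 1 + 2 * z) (m+[n∸m]≡n e≤m)
  ...   | no e≰m with m <? e + 1 ∸ W
  ...     | yes m<N = inj₁ (∈-++⁺ˡ (∈-applyUpTo⁺ (λ m → 1 + 2 * m) m<N))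
  ...     | no m≮N  = inj₂ (squeezed-defect-free m (≰⇒> e≰m) (overflowsᵇ (≮⇒≥ m≮N)))

  unique : Unique offsetsᵇ
  unique = Unique.++⁺ (Unique.applyUpTo⁺₁ _ _ (λ i<j _ → <⇒≢ (s≤s (*-monoʳ-< 2 i<j))))
             (Unique.++⁺ (Unique.applyUpTo⁺₁ _ _ (λ i<j _ → <⇒≢ (s≤s (*-monoʳ-< 2 (+-monoʳ-< e i<j)))))
                         (((1+n≢n ∘ sym) ∷ᵃ []ᵃ) ∷ᴬ ([]ᵃ ∷ᴬ []ᴬ))
                         (λ (v∈defective , v∈bb) → <⇒≱ (proj₂ (defective-bounds v∈defective)) (proj₁ (bb-bounds v∈bb))))
             disjoint
    where
      disjoint : ∀ {v} → ¬ (v ∈ defect-free-offsets × v ∈ defective-offsets ++ 2 * t ∷ 1 + 2 * t ∷ [])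
      disjoint (v∈defect-free , v∈rest) with ∈-++⁻ defective-offsets v∈rest
      ... | inj₁ v∈defective = <⇒≱ (defect-free<1+2e v∈defect-free) (proj₁ (defective-bounds v∈defective))
      ... | inj₂ v∈bb = <⇒≱ (<-trans (defect-free<1+2e v∈defect-free) 1+2e<2t) (proj₁ (bb-bounds v∈bb))

  W≤e : W ≤ e
  W≤e = *-cancelˡ-≤ 2 (+-cancelʳ-≤ (2 * κ) (2 * W) (2 * e)
          (≤-trans (+-mono-≤ 2W≤w 2κ≤k) (subst (w + k ≤_) (sym 2e+2κ≡2t) w+k≤2t)))

  length-offsets : length offsetsᵇ ≡ t + 3 ∸ W
  length-offsets = begin
    length offsetsᵇ                    ≡⟨ length-++ defect-free-offsets ⟩
    length defect-free-offsets + length (defective-offsets ++ 2 * t ∷ 1 + 2 * t ∷ [])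
                                       ≡⟨ cong₂ _+_ (length-applyUpTo _ (e + 1 ∸ W))
                                                    (trans (length-++ defective-offsets) (cong (_+ 2) (length-applyUpTo _ κ))) ⟩
    e + 1 ∸ W + (κ + 2)                ≡⟨ cong (_+ (κ + 2)) (+-∸-comm 1 W≤e) ⟩
    e ∸ W + 1 + (κ + 2)                ≡⟨ rearrange (e ∸ W) κ ⟩
    e ∸ W + κ + 3                      ≡⟨ cong (_+ 3) (+-∸-comm κ W≤e) ⟨
    e + κ ∸ W + 3                      ≡⟨ cong (λ z → z ∸ W + 3) e+κ≡t ⟩
    t ∸ W + 3                          ≡⟨ +-∸-comm 3 (≤-trans W≤e (m∸n≤m t κ)) ⟨
    t + 3 ∸ W                          ∎
    where
      open ≡-Reasoning
      rearrange : ∀ x y → x + 1 + (y + 2) ≡ x + y + 3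
      rearrange x y = solve (x ∷ y ∷ [])

  count : ∀ {n} (S : Vec A n) s → 2 * L < s → fragment S (s ∸ 2 * L) (5 * L) ≡ concat (replicate 5 (Tword a b t)) →
          HasCount (λ x → Minimizers.InM _≺_ S w k x × s ≤ x × x ≤ s + L ∸ 1) (t + 3 ∸ W)
  count S s 2L<s T⁵ = subst (HasCount _) length-offsets
    (CentralBlock.minimizer-count S s 2L<s T⁵ offsetsᵇ offset<L offset-minimum classify unique)

rem-even : ∀ m → 2 * m % 2 ≡ 0
rem-even m = trans (cong (_% 2) (*-comm 2 m)) (m*n%n≡0 m 2)

rem-odd : ∀ m → (1 + 2 * m) % 2 ≡ 1
rem-odd m = trans (cong (λ z → (1 + z) % 2) (*-comm 2 m)) ([m+kn]%n≡m%n 1 m 2)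

half-even : ∀ m → 2 * m / 2 ≡ m
half-even m = trans (cong (_/ 2) (*-comm 2 m)) (m*n/n≡m m 2)

half-odd : ∀ m → (1 + 2 * m) / 2 ≡ m
half-odd m = trans (+-distrib-/ 1 (2 * m) (subst (λ z → 1 + z < 2) (sym (rem-even m)) ≤-refl)) (half-even m)

half-bounds : ∀ n → 2 * (n / 2) ≤ n × n ≤ suc (2 * (n / 2))
half-bounds n with even-or-odd n
... | inj₁ (m , refl) rewrite half-even m = ≤-refl , n≤1+n (2 * m)
... | inj₂ (m , refl) rewrite half-odd m = n≤1+n (2 * m) , ≤-refl

count-shift : ∀ {t} W {x} d → t ≡ W + x → t + d ∸ W ≡ x + d
count-shift W {x} d refl = trans (cong (_∸ W) (+-assoc W x d)) (m+n∸m≡n W (x + d))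

count-formulas : ∀ w k → let t = (w + k + 1) / 2 ; W = w / 2 ; p = (w + k) % 2 in
                 (k % 2 ≡ 0 → t + 2 ∸ W ≡ k / 2 + 2 + p × t + 3 ∸ W ≡ k / 2 + 3 + p) ×
                 (k % 2 ≡ 1 → t + 2 ∸ W ≡ k / 2 + 3 × t + 3 ∸ W ≡ k / 2 + 4)
count-formulas w k with even-or-odd w | even-or-odd k
... | inj₁ (W , refl) | inj₁ (κ , refl) rewrite half-even W | half-even κ | rem-even κ =
  (λ _ → trans (count-shift W 2 t≡) (trans (sym (+-identityʳ _)) (cong (κ + 2 +_) (sym p≡))) ,
         trans (count-shift W 3 t≡) (trans (sym (+-identityʳ _)) (cong (κ + 3 +_) (sym p≡)))) ,
  (λ ())
  where
    sum≡ : 2 * W + 2 * κ + 1 ≡ 1 + 2 * (W + κ)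
    sum≡ = solve (W ∷ κ ∷ [])
    t≡ : (2 * W + 2 * κ + 1) / 2 ≡ W + κ
    t≡ = trans (cong (_/ 2) sum≡) (half-odd (W + κ))
    p≡ : (2 * W + 2 * κ) % 2 ≡ 0
    p≡ = trans (cong (_% 2) (sym (*-distribˡ-+ 2 W κ))) (rem-even (W + κ))
... | inj₂ (W , refl) | inj₁ (κ , refl) rewrite half-odd W | half-even κ | rem-even κ =
  (λ _ → trans (count-shift W 2 t≡) (trans (reorder 2) (cong (κ + 2 +_) (sym p≡))) ,
         trans (count-shift W 3 t≡) (trans (reorder 3) (cong (κ + 3 +_) (sym p≡)))) ,
  (λ ())
  where
    reorder : ∀ d → κ + 1 + d ≡ κ + d + 1
    reorder d = solve (κ ∷ d ∷ [])
    sum≡ : 1 + 2 * W + 2 * κ + 1 ≡ 2 * (W + (κ + 1))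
    sum≡ = solve (W ∷ κ ∷ [])
    t≡ : (1 + 2 * W + 2 * κ + 1) / 2 ≡ W + (κ + 1)
    t≡ = trans (cong (_/ 2) sum≡) (half-even (W + (κ + 1)))
    p≡ : (1 + 2 * W + 2 * κ) % 2 ≡ 1
    p≡ = trans (cong (λ z → suc z % 2) (sym (*-distribˡ-+ 2 W κ))) (rem-odd (W + κ))
... | inj₁ (W , refl) | inj₂ (κ , refl) rewrite half-even W | half-odd κ | rem-odd κ =
  (λ ()) ,
  (λ _ → trans (count-shift W 2 t≡) (reorder 2) , trans (count-shift W 3 t≡) (reorder 3))
  where
    reorder : ∀ d → κ + 1 + d ≡ κ + suc d
    reorder d = solve (κ ∷ d ∷ [])
    sum≡ : 2 * W + (1 + 2 * κ) + 1 ≡ 2 * (W + (κ + 1))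
    sum≡ = solve (W ∷ κ ∷ [])
    t≡ : (2 * W + (1 + 2 * κ) + 1) / 2 ≡ W + (κ + 1)
    t≡ = trans (cong (_/ 2) sum≡) (half-even (W + (κ + 1)))
... | inj₂ (W , refl) | inj₂ (κ , refl) rewrite half-odd W | half-odd κ | rem-odd κ =
  (λ ()) ,
  (λ _ → trans (count-shift W 2 t≡) (reorder 2) , trans (count-shift W 3 t≡) (reorder 3))
  where
    reorder : ∀ d → κ + 1 + d ≡ κ + suc d
    reorder d = solve (κ ∷ d ∷ [])
    sum≡ : 1 + 2 * W + (1 + 2 * κ) + 1 ≡ 1 + 2 * (W + (κ + 1))
    sum≡ = solve (W ∷ κ ∷ [])
    t≡ : (1 + 2 * W + (1 + 2 * κ) + 1) / 2 ≡ W + (κ + 1)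
    t≡ = trans (cong (_/ 2) sum≡) (half-odd (W + (κ + 1)))

minimizers-in-block : ∀ {A : Set} {_≺_ : Rel A 0ℓ} → IsStrictTotalOrder _≡_ _≺_ → ∀ {w k} (a b : A) →
                      4 ≤ w → w ≤ suc k → ∀ {n} (S : Vec A n) s →
                      let t = (w + k + 1) / 2
                          L = 2 * t + 2
                          M : ℕ → Set
                          M N = HasCount (λ x → Minimizers.InM _≺_ S w k x × s ≤ x × x ≤ s + L ∸ 1) N
                      in 2 * L < s → fragment S (s ∸ 2 * L) (5 * L) ≡ concat (replicate 5 (Tword a b t)) →
                         (a ≺ b → M (t + 2 ∸ w / 2)) × (b ≺ a → M (t + 3 ∸ w / 2))
minimizers-in-block {_≺_ = _≺_} sto {w} {k} a b 4≤w w≤1+k S s 2L<s T⁵ =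
  (λ a≺b → back-to-statement (Count-a≺b.count sto a b {t} {k} {w} {w / 2} a≺b 4≤w w≤1+k w+k≤2t
                                (proj₁ (half-bounds w)) (proj₂ (half-bounds w)) S s 2L<s′ T⁵′)) ,
  (λ b≺a → back-to-statement (Count-b≺a.count sto a b {t} {k} {w} {w / 2} {k / 2} b≺a 4≤w w≤1+k w+k≤2t
                                (proj₁ (half-bounds w)) (proj₂ (half-bounds w)) (proj₁ (half-bounds k)) (proj₂ (half-bounds k))
                                S s 2L<s′ T⁵′))
  where
    t : ℕ
    t = (w + k + 1) / 2
    L≡ : 2 * t + 2 ≡ 2 + 2 * t
    L≡ = +-comm (2 * t) 2
    Minimizers-in : ℕ → ℕ → Set
    Minimizers-in L N = HasCount (λ x → Minimizers.InM _≺_ S w k x × s ≤ x × x ≤ s + L ∸ 1) N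
    back-to-statement : ∀ {N} → Minimizers-in (2 + 2 * t) N → Minimizers-in (2 * t + 2) N
    back-to-statement {N} = subst (λ L → Minimizers-in L N) (sym L≡)
    2L<s′ : 2 * (2 + 2 * t) < s
    2L<s′ = subst (λ L → 2 * L < s) L≡ 2L<s
    T⁵′ : fragment S (s ∸ 2 * (2 + 2 * t)) (5 * (2 + 2 * t)) ≡ concat (replicate 5 (Tword a b t))
    T⁵′ = subst (λ L → fragment S (s ∸ 2 * L) (5 * L) ≡ concat (replicate 5 (Tword a b t))) L≡ T⁵
    w+k≤2t : w + k ≤ 2 * t
    w+k≤2t = ≤-pred (subst (_≤ suc (2 * t)) (+-comm (w + k) 1) (proj₂ (half-bounds (w + k + 1))))

lemma10 : (w k : ℕ) → 3 < w → w < k + 2 →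
          (A : Set) (a b : A) → a ≢ b →
          (n : ℕ) (S : Vec A n) (s : ℕ) →
          2 * (2 * ((w + k + 1) / 2) + 2) < s →
          fragment S (s ∸ 2 * (2 * ((w + k + 1) / 2) + 2)) (5 * (2 * ((w + k + 1) / 2) + 2))
            ≡ concat (replicate 5 (Tword a b ((w + k + 1) / 2))) →
          (_≺_ : Rel A 0ℓ) → IsStrictTotalOrder _≡_ _≺_ →
          let t = (w + k + 1) / 2
              p = (w + k) % 2
              L = 2 * t + 2
              M : ℕ → Set
              M N = HasCount (λ x → Minimizers.InM _≺_ S w k x × s ≤ x × x ≤ s + L ∸ 1) N
          in (k % 2 ≡ 0 → (a ≺ b → M (k / 2 + 2 + p)) × (b ≺ a → M (k / 2 + 3 + p)))
           × (k % 2 ≡ 1 → (a ≺ b → M (k / 2 + 3)) × (b ≺ a → M (k / 2 + 4)))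
lemma10 w k 3<w w<k+2 A a b _ n S s 2L<s T⁵ _≺_ sto =
  (λ k-even → recount (proj₁ (proj₁ (count-formulas w k) k-even)) ∘ proj₁ counts ,
              recount (proj₂ (proj₁ (count-formulas w k) k-even)) ∘ proj₂ counts) ,
  (λ k-odd  → recount (proj₁ (proj₂ (count-formulas w k) k-odd)) ∘ proj₁ counts ,
              recount (proj₂ (proj₂ (count-formulas w k) k-odd)) ∘ proj₂ counts)
  where
    t : ℕ
    t = (w + k + 1) / 2
    M : ℕ → Set
    M N = HasCount (λ x → Minimizers.InM _≺_ S w k x × s ≤ x × x ≤ s + (2 * t + 2) ∸ 1) N
    recount : ∀ {N N'} → N ≡ N' → M N → M N'
    recount = subst M
    counts : (a ≺ b → M (t + 2 ∸ w / 2)) × (b ≺ a → M (t + 3 ∸ w / 2))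
    counts = minimizers-in-block sto a b 3<w (≤-pred (subst (suc w ≤_) (+-comm k 2) w<k+2)) S s 2L<s T⁵
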